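{- Let $G$ be a finite simple graph. (1) If $|V(G)|\ge 2$ and $G'$ is obtained from $G$ by adding a pendant vertex (a new vertex joined by one edge to a vertex of $G$), then $\gamma(G')=\gamma(G)$. (2) If $G''$ is obtained from $G$ by adding a false twin of a non-isolated vertex $v$ (a new vertex adjacent exactly to the neighbors of $v$, not to $v$), then $\gamma(G'')=\gamma(G)$. (3) If $G'''$ is obtained from $G$ by adding a true twin of a non-isolated vertex $v$ (a new vertex adjacent to $v$ and exactly to the neighbors of $v$), then $\gamma(G''')=2\gamma(G)$.
   Context: $q_N(K;x)=\sum_{W\subseteq V(K)}(x-1)^{n(K[W])}$, where $n(K[W])$ is the $\mathbb{F}_2$-nullity of the adjacency matrix of the induced subgraph $K[W]$ (the empty set contributing $1$). The $\gamma$ invariant $\gamma(K)$ is the coefficient of $x^1$ in $q_N(K;x)$. -}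

module Defs where

open import Data.Nat using (ℕ; zero; suc)
open import Data.Nat.Logarithm using (⌊log₂_⌋)
open import Data.Bool using (Bool; true; false; _∧_; _∨_; _xor_; not; if_then_else_)
open import Data.Fin using (Fin; zero; suc)
open import Data.Fin.Properties using (_≟_)
open import Data.Vec using (Vec; []; _∷_; lookup)
open import Data.List using (List; []; _∷_; _++_; map; length; foldr; filter; lookup)
open import Data.Integer using (ℤ; +_; -_) renaming (_+_ to _+ℤ_; _*_ to _*ℤ_)
open import Data.Product using (_×_; Σ; ∃)
open import Relation.Nullary.Decidable using (⌊_⌋)
open import Relation.Binary.PropositionalEquality using (_≡_; refl)

record Graph (n : ℕ) : Set where
  field
    adj     : Fin n → Fin n → Bool
    sym     : ∀ i j → adj i j ≡ adj j i
    irrefl  : ∀ i → adj i i ≡ false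
open Graph public

-- Add a new vertex (index zero; old vertex i becomes suc i) whose
-- neighbourhood among the old vertices is given by N.
extend : ∀ {n} → Graph n → (Fin n → Bool) → Graph (suc n)
extend {n} G N = record { adj = a ; sym = s ; irrefl = r }
  where
  a : Fin (suc n) → Fin (suc n) → Bool
  a zero    zero    = false
  a zero    (suc j) = N j
  a (suc i) zero    = N i
  a (suc i) (suc j) = adj G i j
  s : ∀ i j → a i j ≡ a j i
  s zero    zero    = refl
  s zero    (suc j) = refl
  s (suc i) zero    = refl
  s (suc i) (suc j) = sym G i j
  r : ∀ i → a i i ≡ false
  r zero    = refl
  r (suc i) = irrefl G i

addPendant : ∀ {n} → Graph n → Fin n → Graph (suc n)
addPendant G u = extend G (λ j → ⌊ j ≟ u ⌋)

addFalseTwin : ∀ {n} → Graph n → Fin n → Graph (suc n)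
addFalseTwin G v = extend G (λ j → adj G v j)

addTrueTwin : ∀ {n} → Graph n → Fin n → Graph (suc n)
addTrueTwin G v = extend G (λ j → adj G v j ∨ ⌊ j ≟ v ⌋)

NonIsolated : ∀ {n} → Graph n → Fin n → Set
NonIsolated G v = ∃ λ w → adj G v w ≡ true

-- all vectors of F₂^m (equivalently all subsets of Fin m)
allVecs : (m : ℕ) → List (Vec Bool m)
allVecs zero    = [] ∷ []
allVecs (suc m) = map (false ∷_) (allVecs m) ++ map (true ∷_) (allVecs m)

xorSum : ∀ m → (Fin m → Bool) → Bool
xorSum zero    f = false
xorSum (suc m) f = f zero xor xorSum m (λ i → f (suc i))

allFin? : ∀ m → (Fin m → Bool) → Bool
allFin? zero    f = true
allFin? (suc m) f = f zero ∧ allFin? m (λ i → f (suc i))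

inKernel : ∀ {m} → (Fin m → Fin m → Bool) → Vec Bool m → Bool
inKernel {m} M x = allFin? m (λ i → not (xorSum m (λ j → M i j ∧ Data.Vec.lookup x j)))

kernel : ∀ {m} → (Fin m → Fin m → Bool) → List (Vec Bool m)
kernel {m} M = filter (λ x → inKernel M x Data.Bool.≟ true) (allVecs m)
  where import Data.Bool

-- F₂-nullity = dim ker M = log₂ |ker M|  (|ker M| = 2^dim)
nullity : ∀ {m} → (Fin m → Fin m → Bool) → ℕ
nullity M = ⌊log₂ length (kernel M) ⌋

members : ∀ {n} → Vec Bool n → List (Fin n)
members []          = []
members (b ∷ W) = if b then zero ∷ rest else rest
  where rest = map suc (members W)

inducedAdj : ∀ {n} → Graph n → (W : Vec Bool n) →
             Fin (length (members W)) → Fin (length (members W)) → Bool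
inducedAdj G W i j = adj G (Data.List.lookup (members W) i) (Data.List.lookup (members W) j)

-- Integer polynomials as coefficient lists (constant term first)

Poly : Set
Poly = List ℤ

_⊕_ : Poly → Poly → Poly
[]       ⊕ q        = q
(a ∷ p)  ⊕ []       = a ∷ p
(a ∷ p)  ⊕ (b ∷ q)  = (a +ℤ b) ∷ (p ⊕ q)

scale : ℤ → Poly → Poly
scale c = map (c *ℤ_)

_⊗_ : Poly → Poly → Poly
[]      ⊗ q = []
(a ∷ p) ⊗ q = scale a q ⊕ (+ 0 ∷ (p ⊗ q))

pow : Poly → ℕ → Poly
pow p zero    = + 1 ∷ []
pow p (suc k) = p ⊗ pow p k

coeff : Poly → ℕ → ℤ
coeff []      k       = + 0
coeff (a ∷ p) zero    = a
coeff (a ∷ p) (suc k) = coeff p k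

xMinus1 : Poly
xMinus1 = - (+ 1) ∷ + 1 ∷ []

sumPoly : List Poly → Poly
sumPoly = foldr _⊕_ []

qN : ∀ {n} → Graph n → Poly
qN {n} G = sumPoly (map (λ W → pow xMinus1 (nullity (inducedAdj G W))) (allVecs n))

γ : ∀ {n} → Graph n → ℤ
γ G = coeff (qN G) 1

{-# OPTIONS --safe #-}
-- Write c₁ k for the coefficient of x in (x - 1)^k, so that γ(G) = Σ_W c₁ (n(G[W])) and
-- c₁ k + c₁ (k + 1) = (-1)^k.  When a vertex z attached at v is added, the subsets avoiding z
-- contribute γ(G); the others are grouped in pairs {W + z, W + v + z} with v ∉ W, whose
-- nullities are found by counting kernel vectors: n(G[W]) + 1 and n(G[W]) for a pendant vertex,
-- n(G[W + v]) and n(G[W + v]) + 1 for a false twin, n(G[W + v]) and n(G[W]) for a true twin.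
-- For a true twin the pairs therefore reassemble γ(G).  In the other two cases a pair
-- contributes (-1)^n(G[U]) for U = W resp. W + v, and this is (-1)^|U|: the adjacency matrix
-- of a simple graph is alternating, so its rank is even (an isolated vertex doubles the kernel,
-- and pivoting on an edge uw removes u and w without changing it).  These signs cancel between
-- W and W + u′ for one more vertex u′: any other vertex for a pendant, a neighbour of v for a
-- false twin.
module Submission where

open import Defs
open import Data.Nat using (ℕ; _≤_)
open import Data.Fin using (Fin)
open import Data.Integer using (+_; _*_)
open import Data.Product using (_×_)
open import Relation.Binary.PropositionalEquality using (_≡_)

open import Algebra.Bundles using (CommutativeMonoid; CommutativeRing)
import Algebra.Properties.CommutativeSemigroup as CommutativeSemigroupProperties
open import Data.Bool using (Bool; true; false; not; _∧_; _∨_; _xor_; if_then_else_)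
import Data.Bool.Properties as Bool
open import Data.Fin using (zero; suc)
open import Data.Fin.Properties using (_≟_; any?)
open import Data.Fin.Subset using (Subset; ∣_∣; ⊥)
open import Data.Fin.Subset.Properties using (nonempty?; Empty-unique; ∣⊥∣≡0)
open import Data.Nat using (zero; suc; _+_; _^_; s≤s)
open import Data.Nat.Logarithm using (⌊log₂_⌋; ⌊log₂[2^n]⌋≡n)
import Data.Nat.Properties as NatP
open import Data.Product using (Σ; _,_; proj₂)
open import Data.Integer using (ℤ; -_; 0ℤ; 1ℤ; -1ℤ) renaming (_+_ to _+ℤ_; _^_ to _^ℤ_)
import Data.Integer.Properties as IntP
open import Data.Vec using (Vec; []; _∷_; lookup; _[_]≔_)
open import Data.List using (List; []; _∷_; _++_; map; length; filter)
open import Data.Bool.ListAction using (all; and)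
import Data.List as List
import Data.List.Properties as List
open import Data.Vec.Properties using (lookup∘update; lookup∘update′; []≔-idempotent; []≔-commutes; []≔-lookup; []=⇒lookup)
open import Function using (_∘_)
open import Relation.Binary.PropositionalEquality
  using (refl; cong; cong₂; trans; subst; _≢_; module ≡-Reasoning)
import Relation.Binary.PropositionalEquality as ≡
open import Relation.Nullary using (yes; no)
open import Relation.Nullary.Decidable using (⌊_⌋; isYes≗does; dec-true; dec-false; _×-dec_)

module Xor = CommutativeSemigroupProperties
  (CommutativeRing.+-commutativeSemigroup Bool.xor-∧-commutativeRing)
module And = CommutativeSemigroupProperties
  (CommutativeMonoid.commutativeSemigroup Bool.∧-commutativeMonoid)

infix 4 _==_
_==_ : Bool → Bool → Bool
a == b = not (a xor b)

==⇒≡ : ∀ {a b} → (a == b) ≡ true → a ≡ b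
==⇒≡ {true}  {true}  _ = refl
==⇒≡ {false} {false} _ = refl

∧-congʳ-if : ∀ a {b c} → (a ≡ true → b ≡ c) → a ∧ b ≡ a ∧ c
∧-congʳ-if true  b≡c = b≡c refl
∧-congʳ-if false _   = refl

not∧-congʳ-if : ∀ a {b c} → (a ≡ false → b ≡ c) → not a ∧ b ≡ not a ∧ c
not∧-congʳ-if true  _   = refl
not∧-congʳ-if false b≡c = b≡c refl

xor-cancelˡ : ∀ a r → a xor (a xor r) ≡ r
xor-cancelˡ a r = trans (≡.sym (Bool.xor-assoc a a r)) (cong (_xor r) (Bool.xor-same a))

⌊≟⌋-refl : ∀ {n} (v : Fin n) → ⌊ v ≟ v ⌋ ≡ true
⌊≟⌋-refl v = trans (isYes≗does (v ≟ v)) (dec-true (v ≟ v) refl)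

⌊≟⌋-≢ : ∀ {n} {i v : Fin n} → i ≢ v → ⌊ i ≟ v ⌋ ≡ false
⌊≟⌋-≢ {i = i} {v} i≢v = trans (isYes≗does (i ≟ v)) (dec-false (i ≟ v) i≢v)

[]≔-unchanged : ∀ {n} {A : Set} (x : Vec A n) {u a} → lookup x u ≡ a → x [ u ]≔ a ≡ x
[]≔-unchanged x {u} refl = []≔-lookup x u

lookup-true⇒≢ : ∀ {n} (x : Vec Bool n) {u i} → lookup (x [ u ]≔ false) i ≡ true → i ≢ u
lookup-true⇒≢ x {u} xᵢ refl with () ← trans (≡.sym xᵢ) (lookup∘update u x false)

-- Vectors over F₂ and subsets

-- The vector entry comes first, so that a zero entry kills its term definitionally.
infixl 7 _·_
_·_ : ∀ {n} → Vec Bool n → (Fin n → Bool) → Bool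
[]      · g = false
(c ∷ x) · g = (c ∧ g zero) xor (x · (g ∘ suc))

allIn : ∀ {n} → Subset n → (Fin n → Bool) → Bool
allIn []      φ = true
allIn (b ∷ W) φ = (not b ∨ φ zero) ∧ allIn W (φ ∘ suc)

infix 5 _⊆ᵇ_
_⊆ᵇ_ : ∀ {n} → Vec Bool n → Subset n → Bool
x ⊆ᵇ W = allIn x (lookup W)

allIn-cong : ∀ {n} (W : Subset n) {φ ψ} → (∀ i → lookup W i ≡ true → φ i ≡ ψ i) →
             allIn W φ ≡ allIn W ψ
allIn-cong []          φ≡ψ = refl
allIn-cong (true  ∷ W) φ≡ψ = cong₂ _∧_ (φ≡ψ zero refl) (allIn-cong W (φ≡ψ ∘ suc))
allIn-cong (false ∷ W) φ≡ψ = allIn-cong W (φ≡ψ ∘ suc)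

allIn-at : ∀ {n} (W : Subset n) φ u → allIn W φ ≡ (not (lookup W u) ∨ φ u) ∧ allIn (W [ u ]≔ false) φ
allIn-at (b ∷ W) φ zero    = refl
allIn-at (b ∷ W) φ (suc u) = trans (cong ((not b ∨ φ zero) ∧_) (allIn-at W (φ ∘ suc) u))
  (And.x∙yz≈y∙xz (not b ∨ φ zero) (not (lookup W u) ∨ φ (suc u)) _)

allIn-member : ∀ {n} (W : Subset n) φ {u} → lookup W u ≡ true → allIn W φ ≡ φ u ∧ allIn (W [ u ]≔ false) φ
allIn-member W φ {u} u∈W = trans (allIn-at W φ u) (cong (λ b → (not b ∨ φ u) ∧ allIn (W [ u ]≔ false) φ) u∈W)

allIn-insert : ∀ {n} (W : Subset n) φ {u} → lookup W u ≡ false → allIn (W [ u ]≔ true) φ ≡ φ u ∧ allIn W φ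
allIn-insert W φ {u} u∉W = begin
  allIn (W [ u ]≔ true) φ                    ≡⟨ allIn-member (W [ u ]≔ true) φ (lookup∘update u W true) ⟩
  φ u ∧ allIn ((W [ u ]≔ true) [ u ]≔ false) φ ≡⟨ cong (λ V → φ u ∧ allIn V φ) ([]≔-idempotent W u) ⟩
  φ u ∧ allIn (W [ u ]≔ false) φ             ≡⟨ cong (λ V → φ u ∧ allIn V φ) ([]≔-unchanged W u∉W) ⟩
  φ u ∧ allIn W φ                            ∎
  where open ≡-Reasoning

∈-[]≔false⇒∈ : ∀ {n} (W : Subset n) {u i} → lookup (W [ u ]≔ false) i ≡ true → lookup W i ≡ true
∈-[]≔false⇒∈ W i∈W′ = trans (≡.sym (lookup∘update′ (lookup-true⇒≢ W i∈W′) W false)) i∈W′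

∈∉⇒≢ : ∀ {n} (W : Subset n) {i v} → lookup W i ≡ true → lookup W v ≡ false → i ≢ v
∈∉⇒≢ W i∈W v∉W refl with () ← trans (≡.sym i∈W) v∉W

⊆ᵇ-[]≔ : ∀ {n} (x : Vec Bool n) (W : Subset n) u b →
         x ⊆ᵇ W [ u ]≔ b ≡ (not (lookup x u) ∨ b) ∧ (x [ u ]≔ false ⊆ᵇ W)
⊆ᵇ-[]≔ x W u b = trans (allIn-at x _ u) (cong₂ (λ c d → (not (lookup x u) ∨ c) ∧ d)
  (lookup∘update u W b)
  (allIn-cong (x [ u ]≔ false) (λ i xᵢ → lookup∘update′ (lookup-true⇒≢ x xᵢ) W b)))

⊆ᵇ-insert : ∀ {n} (x : Vec Bool n) W u → x ⊆ᵇ W [ u ]≔ true ≡ x [ u ]≔ false ⊆ᵇ W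
⊆ᵇ-insert x W u = trans (⊆ᵇ-[]≔ x W u true) (cong (_∧ (x [ u ]≔ false ⊆ᵇ W)) (Bool.∨-zeroʳ (not (lookup x u))))

⊆ᵇ-remove : ∀ {n} (x : Vec Bool n) (W : Subset n) {u} → lookup W u ≡ true →
            x ⊆ᵇ W ≡ x [ u ]≔ false ⊆ᵇ W [ u ]≔ false
⊆ᵇ-remove x W {u} u∈W = begin
  x ⊆ᵇ W                                         ≡⟨ cong (x ⊆ᵇ_) ([]≔-unchanged W u∈W) ⟨
  x ⊆ᵇ W [ u ]≔ true                             ≡⟨ ⊆ᵇ-insert x W u ⟩
  x′ ⊆ᵇ W                                        ≡⟨ cong (_⊆ᵇ W) ([]≔-idempotent x u) ⟨
  x′ [ u ]≔ false ⊆ᵇ W                           ≡⟨ cong (λ b → (not b ∨ false) ∧ (x′ [ u ]≔ false ⊆ᵇ W)) (lookup∘update u x false) ⟨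
  (not (lookup x′ u) ∨ false) ∧ (x′ [ u ]≔ false ⊆ᵇ W) ≡⟨ ⊆ᵇ-[]≔ x′ W u false ⟨
  x′ ⊆ᵇ W [ u ]≔ false                           ∎
  where
  open ≡-Reasoning
  x′ = x [ u ]≔ false

⊆ᵇ-avoid : ∀ {n} (x : Vec Bool n) W {u} → lookup W u ≡ false → x ⊆ᵇ W ≡ not (lookup x u) ∧ (x [ u ]≔ false ⊆ᵇ W)
⊆ᵇ-avoid x W {u} u∉W = trans (allIn-at x (lookup W) u)
  (cong (_∧ (x [ u ]≔ false ⊆ᵇ W)) (trans (cong (not (lookup x u) ∨_) u∉W) (Bool.∨-identityʳ (not (lookup x u)))))

⊆ᵇ-outside : ∀ {n} (x : Vec Bool n) (W : Subset n) {u} → lookup W u ≡ false → lookup x u ≡ true → x ⊆ᵇ W ≡ false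
⊆ᵇ-outside x W {u} u∉W xᵤ = begin
  x ⊆ᵇ W                                    ≡⟨ allIn-at x (lookup W) u ⟩
  (not (lookup x u) ∨ lookup W u) ∧ rest    ≡⟨ cong₂ (λ a b → (not a ∨ b) ∧ rest) xᵤ u∉W ⟩
  false                                     ∎
  where
  open ≡-Reasoning
  rest = x [ u ]≔ false ⊆ᵇ W

⊆ᵇ⇒∉ : ∀ {n} (x : Vec Bool n) W {u} → x ⊆ᵇ W ≡ true → lookup W u ≡ false → lookup x u ≡ false
⊆ᵇ⇒∉ x W {u} x⊆W u∉W with lookup x u in xᵤ
... | false = refl
... | true with () ← trans (≡.sym x⊆W) (⊆ᵇ-outside x W u∉W xᵤ)

·-cong : ∀ {n} (x : Vec Bool n) {g h} → (∀ j → g j ≡ h j) → x · g ≡ x · h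
·-cong []      g≡h = refl
·-cong (c ∷ x) g≡h = cong₂ (λ a b → (c ∧ a) xor b) (g≡h zero) (·-cong x (g≡h ∘ suc))

·-zeroʳ : ∀ {n} (x : Vec Bool n) → x · (λ _ → false) ≡ false
·-zeroʳ []      = refl
·-zeroʳ (c ∷ x) = cong₂ _xor_ (Bool.∧-zeroʳ c) (·-zeroʳ x)

·-[]≔ : ∀ {n} (x : Vec Bool n) g u c → (x [ u ]≔ c) · g ≡ (c ∧ g u) xor ((x [ u ]≔ false) · g)
·-[]≔ (c′ ∷ x) g zero    c = refl
·-[]≔ (c′ ∷ x) g (suc u) c = trans (cong ((c′ ∧ g zero) xor_) (·-[]≔ x (g ∘ suc) u c))
                                   (Xor.x∙yz≈y∙xz (c′ ∧ g zero) (c ∧ g (suc u)) _)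

·-at : ∀ {n} (x : Vec Bool n) g u → x · g ≡ (lookup x u ∧ g u) xor ((x [ u ]≔ false) · g)
·-at x g u = trans (cong (_· g) (≡.sym ([]≔-lookup x u))) (·-[]≔ x g u (lookup x u))

·-[]≔-irrelevant : ∀ {n} (x : Vec Bool n) {g u} c → g u ≡ false → (x [ u ]≔ c) · g ≡ x · g
·-[]≔-irrelevant x {g} {u} c gᵤ = begin
  (x [ u ]≔ c) · g                 ≡⟨ ·-[]≔ x g u c ⟩
  (c ∧ g u) xor rest               ≡⟨ cong (λ a → (c ∧ a) xor rest) gᵤ ⟩
  (c ∧ false) xor rest             ≡⟨ cong (_xor rest) (Bool.∧-zeroʳ c) ⟩
  rest                             ≡⟨ cong (_xor rest) (Bool.∧-zeroʳ (lookup x u)) ⟨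
  (lookup x u ∧ false) xor rest    ≡⟨ cong (λ a → (lookup x u ∧ a) xor rest) gᵤ ⟨
  (lookup x u ∧ g u) xor rest      ≡⟨ ·-at x g u ⟨
  x · g                            ∎
  where
  open ≡-Reasoning
  rest = (x [ u ]≔ false) · g

·-xor : ∀ {n} (x : Vec Bool n) g h → x · (λ j → g j xor h j) ≡ (x · g) xor (x · h)
·-xor []      g h = refl
·-xor (c ∷ x) g h = trans (cong₂ _xor_ (Bool.∧-distribˡ-xor c (g zero) (h zero)) (·-xor x (g ∘ suc) (h ∘ suc)))
                          (Xor.interchange (c ∧ g zero) (c ∧ h zero) _ _)

·-scale : ∀ {n} (x : Vec Bool n) a g → x · (λ j → a ∧ g j) ≡ a ∧ (x · g)
·-scale []      a g = ≡.sym (Bool.∧-zeroʳ a)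
·-scale (c ∷ x) a g = trans (cong₂ _xor_ (And.x∙yz≈y∙xz c a (g zero)) (·-scale x a (g ∘ suc)))
                            (≡.sym (Bool.∧-distribˡ-xor a (c ∧ g zero) (x · (g ∘ suc))))

·-indicator : ∀ {n} (x : Vec Bool n) u → x · (λ j → ⌊ j ≟ u ⌋) ≡ lookup x u
·-indicator (c ∷ x) zero    = trans (cong₂ _xor_ (Bool.∧-identityʳ c) (·-zeroʳ x)) (Bool.xor-identityʳ c)
·-indicator (c ∷ x) (suc u) = begin
  (c ∧ false) xor (x · (λ j → ⌊ suc j ≟ suc u ⌋)) ≡⟨ cong₂ _xor_ (Bool.∧-zeroʳ c) (·-cong x ⌊suc≟suc⌋) ⟩
  x · (λ j → ⌊ j ≟ u ⌋)                           ≡⟨ ·-indicator x u ⟩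
  lookup x u                                      ∎
  where
  open ≡-Reasoning
  ⌊suc≟suc⌋ : ∀ j → ⌊ suc j ≟ suc u ⌋ ≡ ⌊ j ≟ u ⌋
  ⌊suc≟suc⌋ j = trans (isYes≗does (suc j ≟ suc u)) (≡.sym (isYes≗does (j ≟ u)))

·-vanishing : ∀ {n} (x : Vec Bool n) (W : Subset n) {g} → x ⊆ᵇ W ≡ true →
              (∀ j → lookup W j ≡ true → g j ≡ false) → x · g ≡ false
·-vanishing []          []          x⊆W g≡0 = refl
·-vanishing (false ∷ x) (b ∷ W)     x⊆W g≡0 = ·-vanishing x W x⊆W (g≡0 ∘ suc)
·-vanishing (true ∷ x)  (true ∷ W) {g} x⊆W g≡0 =
  trans (cong (_xor (x · (g ∘ suc))) (g≡0 zero refl)) (·-vanishing x W x⊆W (g≡0 ∘ suc))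

-- Sums over F₂ⁿ

module SubsetSum {c ℓ} (M : CommutativeMonoid c ℓ) where

  open CommutativeMonoid M
    using (Carrier; _≈_; _∙_; ε; ∙-cong; ∙-congˡ; identityʳ; setoid; commutativeSemigroup)
    renaming (refl to ≈-refl; trans to ≈-trans)
  open CommutativeSemigroupProperties commutativeSemigroup using (interchange)
  open import Relation.Binary.Reasoning.Setoid setoid

  ∑ : ∀ n → (Vec Bool n → Carrier) → Carrier
  ∑ zero    f = f []
  ∑ (suc n) f = ∑ n (f ∘ (false ∷_)) ∙ ∑ n (f ∘ (true ∷_))

  unless : Bool → Carrier → Carrier
  unless b z = if b then ε else z

  unless-cong : ∀ b {y z} → (b ≡ false → y ≈ z) → unless b y ≈ unless b z
  unless-cong true  _   = ≈-refl
  unless-cong false y≈z = y≈z refl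

  ∑-cong : ∀ n {f g} → (∀ x → f x ≈ g x) → ∑ n f ≈ ∑ n g
  ∑-cong zero    f≈g = f≈g []
  ∑-cong (suc n) f≈g = ∙-cong (∑-cong n (f≈g ∘ (false ∷_))) (∑-cong n (f≈g ∘ (true ∷_)))

  ∑-ε : ∀ n → ∑ n (λ _ → ε) ≈ ε
  ∑-ε zero    = ≈-refl
  ∑-ε (suc n) = ≈-trans (∙-cong (∑-ε n) (∑-ε n)) (identityʳ ε)

  ∑-∙ : ∀ n f g → ∑ n (λ x → f x ∙ g x) ≈ ∑ n f ∙ ∑ n g
  ∑-∙ zero    f g = ≈-refl
  ∑-∙ (suc n) f g = ≈-trans
    (∙-cong (∑-∙ n (f ∘ (false ∷_)) (g ∘ (false ∷_))) (∑-∙ n (f ∘ (true ∷_)) (g ∘ (true ∷_))))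
                            (interchange (∑ n (f ∘ (false ∷_))) (∑ n (g ∘ (false ∷_))) _ _)

  ∑-pair-at : ∀ {n} u f → ∑ n f ≈ ∑ n (λ x → unless (lookup x u) (f x ∙ f (x [ u ]≔ true)))
  ∑-pair-at {suc n} zero    f = begin
    ∑ n (f ∘ (false ∷_)) ∙ ∑ n (f ∘ (true ∷_))                  ≈⟨ ∑-∙ n (f ∘ (false ∷_)) (f ∘ (true ∷_)) ⟨
    ∑ n (λ x → f (false ∷ x) ∙ f (true ∷ x))                   ≈⟨ identityʳ _ ⟨
    ∑ n (λ x → f (false ∷ x) ∙ f (true ∷ x)) ∙ ε               ≈⟨ ∙-congˡ (∑-ε n) ⟨
    ∑ n (λ x → f (false ∷ x) ∙ f (true ∷ x)) ∙ ∑ n (λ _ → ε)   ∎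
  ∑-pair-at {suc n} (suc u) f = ∙-cong (∑-pair-at u (f ∘ (false ∷_))) (∑-pair-at u (f ∘ (true ∷_)))

Ignores : ∀ {n} {A : Set} → Fin n → (Vec Bool n → A) → Set
Ignores u f = ∀ x c → f (x [ u ]≔ c) ≡ f x

Avoids : ∀ {n} → Fin n → (Vec Bool n → Bool) → Set
Avoids u P = ∀ x → lookup x u ≡ true → P x ≡ false

not∧-reset : ∀ {n} {u} {P : Vec Bool n → Bool} → Avoids u P → ∀ x → not (lookup x u) ∧ P (x [ u ]≔ false) ≡ P x
not∧-reset {u = u} {P} avoids x with lookup x u in xᵤ
... | true  = ≡.sym (avoids x xᵤ)
... | false = cong P ([]≔-unchanged x xᵤ)

module ℕ-Sum = SubsetSum NatP.+-0-commutativeMonoid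

𝟙 : Bool → ℕ
𝟙 b = if b then 1 else 0

count : ∀ n → (Vec Bool n → Bool) → ℕ
count n P = ℕ-Sum.∑ n (𝟙 ∘ P)

count-cong : ∀ n {P Q} → (∀ x → P x ≡ Q x) → count n P ≡ count n Q
count-cong n P≡Q = ℕ-Sum.∑-cong n (cong 𝟙 ∘ P≡Q)

count-fibres : ∀ n (P g : Vec Bool n → Bool) →
               count n P ≡ count n (λ x → (false == g x) ∧ P x) + count n (λ x → (true == g x) ∧ P x)
count-fibres n P g = trans (ℕ-Sum.∑-cong n {g = λ x → f₀ x + f₁ x} (λ x → 𝟙-fibres (g x) (P x))) (ℕ-Sum.∑-∙ n f₀ f₁)
  where
  f₀ f₁ : Vec Bool n → ℕ
  f₀ x = 𝟙 ((false == g x) ∧ P x)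
  f₁ x = 𝟙 ((true == g x) ∧ P x)
  𝟙-fibres : ∀ r p → 𝟙 p ≡ 𝟙 ((false == r) ∧ p) + 𝟙 ((true == r) ∧ p)
  𝟙-fibres false p = ≡.sym (NatP.+-identityʳ (𝟙 p))
  𝟙-fibres true  p = refl

count-pair-at : ∀ {n} u (P : Vec Bool n → Bool) →
                count n P ≡ count n (λ x → not (lookup x u) ∧ P x) + count n (λ x → not (lookup x u) ∧ P (x [ u ]≔ true))
count-pair-at {n} u P = begin
  count n P
    ≡⟨ ℕ-Sum.∑-pair-at u (𝟙 ∘ P) ⟩
  ℕ-Sum.∑ n (λ x → ℕ-Sum.unless (lookup x u) (𝟙 (P x) + 𝟙 (P (x [ u ]≔ true))))
    ≡⟨ ℕ-Sum.∑-cong n (λ x → unless-+ (lookup x u) (P x) (P (x [ u ]≔ true))) ⟩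
  ℕ-Sum.∑ n (λ x → 𝟙 (not (lookup x u) ∧ P x) + 𝟙 (not (lookup x u) ∧ P (x [ u ]≔ true)))
    ≡⟨ ℕ-Sum.∑-∙ n (λ x → 𝟙 (not (lookup x u) ∧ P x)) (λ x → 𝟙 (not (lookup x u) ∧ P (x [ u ]≔ true))) ⟩
  count n (λ x → not (lookup x u) ∧ P x) + count n (λ x → not (lookup x u) ∧ P (x [ u ]≔ true)) ∎
  where
  open ≡-Reasoning
  unless-+ : ∀ b p q → ℕ-Sum.unless b (𝟙 p + 𝟙 q) ≡ 𝟙 (not b ∧ p) + 𝟙 (not b ∧ q)
  unless-+ true  p q = refl
  unless-+ false p q = refl

count-ignoring : ∀ {n} u (Q : Vec Bool n → Bool) → Ignores u Q →
                 count n Q ≡ count n (λ x → not (lookup x u) ∧ Q x) + count n (λ x → not (lookup x u) ∧ Q x)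
count-ignoring {n} u Q ignores = trans (count-pair-at u Q)
  (cong (_+_ (count n (λ x → not (lookup x u) ∧ Q x))) (count-cong n (λ x → cong (not (lookup x u) ∧_) (ignores x true))))

count-toggle-at : ∀ {n} u (P : Vec Bool n → Bool) → count n (λ x → P (x [ u ]≔ not (lookup x u))) ≡ count n P
count-toggle-at {n} u P = begin
  count n (P ∘ toggle)                                           ≡⟨ count-pair-at u (P ∘ toggle) ⟩
  count n (λ x → not (lookup x u) ∧ P (toggle x)) + count n (λ x → not (lookup x u) ∧ P (toggle (x [ u ]≔ true)))
    ≡⟨ cong₂ _+_ (count-cong n toggle-unset) (count-cong n toggle-set) ⟩
  count n (λ x → not (lookup x u) ∧ P (x [ u ]≔ true)) + count n (λ x → not (lookup x u) ∧ P x)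
    ≡⟨ NatP.+-comm (count n (λ x → not (lookup x u) ∧ P (x [ u ]≔ true))) _ ⟩
  count n (λ x → not (lookup x u) ∧ P x) + count n (λ x → not (lookup x u) ∧ P (x [ u ]≔ true))
    ≡⟨ count-pair-at u P ⟨
  count n P                                                      ∎
  where
  open ≡-Reasoning
  toggle : Vec Bool n → Vec Bool n
  toggle x = x [ u ]≔ not (lookup x u)
  toggle-unset : ∀ x → not (lookup x u) ∧ P (toggle x) ≡ not (lookup x u) ∧ P (x [ u ]≔ true)
  toggle-unset x = not∧-congʳ-if (lookup x u) (cong (λ b → P (x [ u ]≔ not b)))
  toggle-set : ∀ x → not (lookup x u) ∧ P (toggle (x [ u ]≔ true)) ≡ not (lookup x u) ∧ P x
  toggle-set x = not∧-congʳ-if (lookup x u) λ xᵤ → cong P (begin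
    (x [ u ]≔ true) [ u ]≔ not (lookup (x [ u ]≔ true) u)
      ≡⟨ cong (λ b → (x [ u ]≔ true) [ u ]≔ not b) (lookup∘update u x true) ⟩
    (x [ u ]≔ true) [ u ]≔ false
      ≡⟨ []≔-idempotent x u ⟩
    x [ u ]≔ false
      ≡⟨ []≔-unchanged x xᵤ ⟩
    x ∎)

count-solve-at : ∀ {n} u (g Q : Vec Bool n → Bool) → Ignores u g → Ignores u Q →
                 count n (λ x → (lookup x u == g x) ∧ Q x) ≡ count n (λ x → not (lookup x u) ∧ Q x)
count-solve-at {n} u g Q g-ignores Q-ignores = begin
  count n (λ x → (lookup x u == g x) ∧ Q x)
    ≡⟨ count-pair-at u _ ⟩
  count n (λ x → not (lookup x u) ∧ ((lookup x u == g x) ∧ Q x))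
    + count n (λ x → not (lookup x u) ∧ ((lookup (x [ u ]≔ true) u == g (x [ u ]≔ true)) ∧ Q (x [ u ]≔ true)))
    ≡⟨ cong₂ _+_ (count-cong n unset) (count-cong n set) ⟩
  count n (λ x → (false == g x) ∧ P x) + count n (λ x → (true == g x) ∧ P x)
    ≡⟨ count-fibres n P g ⟨
  count n P ∎
  where
  open ≡-Reasoning
  P : Vec Bool n → Bool
  P x = not (lookup x u) ∧ Q x
  unset : ∀ x → not (lookup x u) ∧ ((lookup x u == g x) ∧ Q x) ≡ (false == g x) ∧ P x
  unset x = trans (not∧-congʳ-if (lookup x u) (cong (λ b → (b == g x) ∧ Q x)))
                  (And.x∙yz≈y∙xz (not (lookup x u)) (false == g x) (Q x))
  set : ∀ x → not (lookup x u) ∧ ((lookup (x [ u ]≔ true) u == g (x [ u ]≔ true)) ∧ Q (x [ u ]≔ true)) ≡ (true == g x) ∧ P x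
  set x = trans (cong (not (lookup x u) ∧_) (begin
    (lookup (x [ u ]≔ true) u == g (x [ u ]≔ true)) ∧ Q (x [ u ]≔ true)
      ≡⟨ cong₂ (λ b q → (b == g (x [ u ]≔ true)) ∧ q) (lookup∘update u x true) (Q-ignores x true) ⟩
    (true == g (x [ u ]≔ true)) ∧ Q x
      ≡⟨ cong (λ c → (true == c) ∧ Q x) (g-ignores x true) ⟩
    (true == g x) ∧ Q x ∎))
    (And.x∙yz≈y∙xz (not (lookup x u)) (true == g x) (Q x))

-- Kernels of induced subgraphs

-- Kernel vectors of the adjacency matrix of G[W], padded with zeros outside W.
inKer : ∀ {n} → Graph n → Subset n → Vec Bool n → Bool
inKer G W x = (x ⊆ᵇ W) ∧ allIn W (λ i → not (x · adj G i))

kerSize : ∀ {n} → Graph n → Subset n → ℕ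
kerSize {n} G W = count n (inKer G W)

ν : ∀ {n} → Graph n → Subset n → ℕ
ν G W = nullity (inducedAdj G W)

inKer-outside : ∀ {n} (G : Graph n) W {u} → lookup W u ≡ false → Avoids u (inKer G W)
inKer-outside G W u∉W x xᵤ = cong (_∧ allIn W (λ i → not (x · adj G i))) (⊆ᵇ-outside x W u∉W xᵤ)

accepted : ∀ {A : Set} → (A → Bool) → List A → ℕ
accepted P xs = length (filter (λ x → P x Bool.≟ true) xs)

accepted-++ : ∀ {A : Set} (P : A → Bool) xs ys → accepted P (xs ++ ys) ≡ accepted P xs + accepted P ys
accepted-++ P xs ys = trans (cong length (List.filter-++ (λ x → P x Bool.≟ true) xs ys)) (List.length-++ (filter _ xs))

accepted-map : ∀ {A B : Set} (f : A → B) (P : B → Bool) xs → accepted P (map f xs) ≡ accepted (P ∘ f) xs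
accepted-map f P []       = refl
accepted-map f P (x ∷ xs) with P (f x)
... | true  = cong suc (accepted-map f P xs)
... | false = accepted-map f P xs

accepted-allVecs : ∀ m (P : Vec Bool m → Bool) → accepted P (allVecs m) ≡ count m P
accepted-allVecs zero    P with P []
... | true  = refl
... | false = refl
accepted-allVecs (suc m) P = begin
  accepted P (map (false ∷_) (allVecs m) ++ map (true ∷_) (allVecs m))
    ≡⟨ accepted-++ P (map (false ∷_) (allVecs m)) _ ⟩
  accepted P (map (false ∷_) (allVecs m)) + accepted P (map (true ∷_) (allVecs m))
    ≡⟨ cong₂ _+_ (accepted-map (false ∷_) P (allVecs m)) (accepted-map (true ∷_) P (allVecs m)) ⟩
  accepted (P ∘ (false ∷_)) (allVecs m) + accepted (P ∘ (true ∷_)) (allVecs m)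
    ≡⟨ cong₂ _+_ (accepted-allVecs m (P ∘ (false ∷_))) (accepted-allVecs m (P ∘ (true ∷_))) ⟩
  count (suc m) P ∎
  where open ≡-Reasoning

dotAlong : ∀ {A : Set} (l : List A) → Vec Bool (length l) → (A → Bool) → Bool
dotAlong []      []      g = false
dotAlong (a ∷ l) (c ∷ y) g = (c ∧ g a) xor dotAlong l y g

xorSum-lookup : ∀ {A : Set} (l : List A) y g →
                xorSum (length l) (λ j → g (List.lookup l j) ∧ lookup y j) ≡ dotAlong l y g
xorSum-lookup []      []      g = refl
xorSum-lookup (a ∷ l) (c ∷ y) g = cong₂ _xor_ (Bool.∧-comm (g a) c) (xorSum-lookup l y g)

allFin?-lookup : ∀ {A : Set} (l : List A) φ → allFin? (length l) (φ ∘ List.lookup l) ≡ all φ l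
allFin?-lookup []      φ = refl
allFin?-lookup (a ∷ l) φ = cong (φ a ∧_) (allFin?-lookup l φ)

all-members     : ∀ {n} (W : Subset n) φ → all φ (members W) ≡ allIn W φ
all-members-suc : ∀ {n} (W : Subset n) φ → all φ (map suc (members W)) ≡ allIn W (φ ∘ suc)

all-members []          φ = refl
all-members (true  ∷ W) φ = cong (φ zero ∧_) (all-members-suc W φ)
all-members (false ∷ W) φ = all-members-suc W φ

all-members-suc W φ = trans (cong and (≡.sym (List.map-∘ (members W)))) (all-members W (φ ∘ suc))

count-along-map : ∀ {A B C : Set} (f : A → B) (l : List A) (R : C → B → Bool) (Φ : (C → Bool) → Bool) →
  count (length (map f l)) (λ y → Φ (λ c → dotAlong (map f l) y (R c))) ≡
  count (length l) (λ y → Φ (λ c → dotAlong l y (R c ∘ f)))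
count-along-map f []      R Φ = refl
count-along-map f (a ∷ l) R Φ =
  cong₂ _+_ (count-along-map f l R (λ s → Φ (λ c → (false ∧ R c (f a)) xor s c)))
            (count-along-map f l R (λ s → Φ (λ c → (true ∧ R c (f a)) xor s c)))

-- Φ is arbitrary so that the induction can absorb the first column into it.
count-members : ∀ {n} {C : Set} (W : Subset n) (R : C → Fin n → Bool) (Φ : (C → Bool) → Bool) →
  count (length (members W)) (λ y → Φ (λ c → dotAlong (members W) y (R c))) ≡
  count n (λ x → (x ⊆ᵇ W) ∧ Φ (λ c → x · R c))
count-members []          R Φ = refl
count-members {suc n} (false ∷ W) R Φ =
  trans (count-along-map suc (members W) R Φ) (trans (count-members W (λ c → R c ∘ suc) Φ) (≡.sym padding))
  where
  P : Vec Bool n → Bool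
  P x = (x ⊆ᵇ W) ∧ Φ (λ c → x · (R c ∘ suc))
  padding : count n P + count n (λ _ → false) ≡ count n P
  padding = trans (cong (_+_ (count n P)) (ℕ-Sum.∑-ε n)) (NatP.+-identityʳ (count n P))
count-members {suc n} (true ∷ W) R Φ = cong₂ _+_ (spread false) (spread true)
  where
  spread : ∀ b → let Φ′ = λ s → Φ (λ c → (b ∧ R c zero) xor s c) in
    count (length (map suc (members W))) (λ y → Φ′ (λ c → dotAlong (map suc (members W)) y (R c))) ≡
    count n (λ x → (x ⊆ᵇ W) ∧ Φ′ (λ c → x · (R c ∘ suc)))
  spread b = trans (count-along-map suc (members W) R Φ′) (count-members W (λ c → R c ∘ suc) Φ′)
    where Φ′ = λ s → Φ (λ c → (b ∧ R c zero) xor s c)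

ν≡log₂kerSize : ∀ {n} (G : Graph n) W → ν G W ≡ ⌊log₂ kerSize G W ⌋
ν≡log₂kerSize {n} G W = cong ⌊log₂_⌋ (begin
  length (kernel (inducedAdj G W))
    ≡⟨ accepted-allVecs (length ms) (inKernel (inducedAdj G W)) ⟩
  count (length ms) (inKernel (inducedAdj G W))
    ≡⟨ count-cong (length ms) (λ y → trans (allFin?-lookup ms _)
         (cong and (List.map-cong (λ a → cong not (xorSum-lookup ms y (adj G a))) ms))) ⟩
  count (length ms) (λ y → all (λ i → not (dotAlong ms y (adj G i))) ms)
    ≡⟨ count-members W (adj G) (λ s → all (not ∘ s) ms) ⟩
  count n (λ x → (x ⊆ᵇ W) ∧ all (λ i → not (x · adj G i)) ms)
    ≡⟨ count-cong n (λ x → cong ((x ⊆ᵇ W) ∧_) (all-members W _)) ⟩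
  kerSize G W ∎)
  where
  open ≡-Reasoning
  ms = members W

-- Kernel dimension

∣[]≔true∣ : ∀ {n} (W : Subset n) {u} → lookup W u ≡ false → ∣ W [ u ]≔ true ∣ ≡ suc ∣ W ∣
∣[]≔true∣ (false ∷ W) {zero}  refl = refl
∣[]≔true∣ (true  ∷ W) {suc u} u∉W = cong suc (∣[]≔true∣ W u∉W)
∣[]≔true∣ (false ∷ W) {suc u} u∉W = ∣[]≔true∣ W u∉W

∣[]≔false∣ : ∀ {n} (W : Subset n) {u} → lookup W u ≡ true → ∣ W ∣ ≡ suc ∣ W [ u ]≔ false ∣
∣[]≔false∣ W {u} u∈W = begin
  ∣ W ∣                             ≡⟨ cong ∣_∣ ([]≔-unchanged W u∈W) ⟨
  ∣ W [ u ]≔ true ∣                 ≡⟨ cong ∣_∣ ([]≔-idempotent W u) ⟨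
  ∣ (W [ u ]≔ false) [ u ]≔ true ∣  ≡⟨ ∣[]≔true∣ (W [ u ]≔ false) (lookup∘update u W false) ⟩
  suc ∣ W [ u ]≔ false ∣            ∎
  where open ≡-Reasoning

-1^suc : ∀ k → -1ℤ ^ℤ suc k ≡ - (-1ℤ ^ℤ k)
-1^suc k = IntP.-1*i≡-i (-1ℤ ^ℤ k)

sign-insert : ∀ {n} (W : Subset n) {u} → lookup W u ≡ false → -1ℤ ^ℤ ∣ W [ u ]≔ true ∣ ≡ - (-1ℤ ^ℤ ∣ W ∣)
sign-insert W u∉W = trans (cong (-1ℤ ^ℤ_) (∣[]≔true∣ W u∉W)) (-1^suc ∣ W ∣)

record KernelDimension {n} (G : Graph n) (W : Subset n) : Set where
  field
    dim           : ℕ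
    kerSize≡2^dim : kerSize G W ≡ 2 ^ dim
    dim-parity    : -1ℤ ^ℤ dim ≡ -1ℤ ^ℤ ∣ W ∣

kerSize-⊥ : ∀ {n} (G : Graph n) → kerSize G ⊥ ≡ 1
kerSize-⊥ {n} G = count-⊥ n (λ x i → not (x · adj G i))
  where
  count-⊥ : ∀ n (ψ : Vec Bool n → Fin n → Bool) → count n (λ x → (x ⊆ᵇ ⊥) ∧ allIn ⊥ (ψ x)) ≡ 1
  count-⊥ zero    ψ = refl
  count-⊥ (suc n) ψ = cong₂ _+_ (count-⊥ n (λ x → ψ (false ∷ x) ∘ suc)) (ℕ-Sum.∑-ε n)

kernelDimension-⊥ : ∀ {n} (G : Graph n) → KernelDimension G ⊥
kernelDimension-⊥ {n} G = record
  { dim = 0 ; kerSize≡2^dim = kerSize-⊥ G ; dim-parity = cong (-1ℤ ^ℤ_) (≡.sym (∣⊥∣≡0 n)) }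

module _ {n} (G : Graph n) (W : Subset n) {u : Fin n} (u∈W : lookup W u ≡ true)
         (isolated : ∀ w → lookup W w ≡ true → adj G u w ≡ false) where

  private
    W′ = W [ u ]≔ false

    inKer-isolated : ∀ x → inKer G W x ≡ inKer G W′ (x [ u ]≔ false)
    inKer-isolated x = begin
      (x ⊆ᵇ W) ∧ allIn W φ                      ≡⟨ cong₂ _∧_ (⊆ᵇ-remove x W u∈W) (allIn-member W φ u∈W) ⟩
      (x′ ⊆ᵇ W′) ∧ (not (x · adj G u) ∧ allIn W′ φ) ≡⟨ ∧-congʳ-if (x′ ⊆ᵇ W′) rows ⟩
      (x′ ⊆ᵇ W′) ∧ allIn W′ φ′                  ∎
      where
      open ≡-Reasoning
      x′ = x [ u ]≔ false
      φ φ′ : Fin n → Bool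
      φ  i = not (x · adj G i)
      φ′ i = not (x′ · adj G i)
      rows : x′ ⊆ᵇ W′ ≡ true → not (x · adj G u) ∧ allIn W′ φ ≡ allIn W′ φ′
      rows x′⊆W′ = cong₂ _∧_
        (cong not (·-vanishing x W (trans (⊆ᵇ-remove x W u∈W) x′⊆W′) isolated))
        (allIn-cong W′ λ i i∈W′ → cong not (≡.sym (·-[]≔-irrelevant x false
          (trans (sym G i u) (isolated i (∈-[]≔false⇒∈ W i∈W′))))))

  kerSize-isolated : kerSize G W ≡ kerSize G W′ + kerSize G W′
  kerSize-isolated = begin
    count n (inKer G W)                    ≡⟨ count-cong n inKer-isolated ⟩
    count n (inKer G W′ ∘ (_[ u ]≔ false)) ≡⟨ count-ignoring u _ (λ x c → cong (inKer G W′) ([]≔-idempotent x u)) ⟩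
    count n reset + count n reset          ≡⟨ cong₂ _+_ (count-cong n reset≡) (count-cong n reset≡) ⟩
    kerSize G W′ + kerSize G W′            ∎
    where
    open ≡-Reasoning
    reset : Vec Bool n → Bool
    reset x = not (lookup x u) ∧ inKer G W′ (x [ u ]≔ false)
    reset≡ : ∀ x → reset x ≡ inKer G W′ x
    reset≡ = not∧-reset (inKer-outside G W′ (lookup∘update u W false))

  kernelDimension-isolated : KernelDimension G W′ → KernelDimension G W
  kernelDimension-isolated d = record
    { dim           = suc dim
    ; kerSize≡2^dim = begin
        kerSize G W                     ≡⟨ kerSize-isolated ⟩
        kerSize G W′ + kerSize G W′     ≡⟨ cong₂ _+_ kerSize≡2^dim kerSize≡2^dim ⟩
        2 ^ dim + 2 ^ dim               ≡⟨ cong (_+_ (2 ^ dim)) (NatP.+-identityʳ (2 ^ dim)) ⟨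
        2 ^ suc dim                     ∎
    ; dim-parity    = begin
        -1ℤ ^ℤ suc dim                  ≡⟨ -1^suc dim ⟩
        - (-1ℤ ^ℤ dim)                  ≡⟨ cong -_ dim-parity ⟩
        - (-1ℤ ^ℤ ∣ W′ ∣)               ≡⟨ -1^suc ∣ W′ ∣ ⟨
        -1ℤ ^ℤ suc ∣ W′ ∣               ≡⟨ cong (-1ℤ ^ℤ_) (∣[]≔false∣ W u∈W) ⟨
        -1ℤ ^ℤ ∣ W ∣                    ∎
    }
    where
    open KernelDimension d
    open ≡-Reasoning

adj-transpose : ∀ {n} (G : Graph n) a b c d → adj G a b ∧ adj G c d ≡ adj G d c ∧ adj G b a
adj-transpose G a b c d = trans (Bool.∧-comm (adj G a b) (adj G c d)) (cong₂ _∧_ (sym G c d) (sym G a b))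

-- In the kernel equations of G[W] with u, w ∈ W adjacent, row u fixes x_w and row w fixes x_u;
-- eliminating them leaves the kernel equations of (pivot G u w)[W - u - w].
pivot : ∀ {n} → Graph n → Fin n → Fin n → Graph n
pivot G u w .adj i j = adj G i j xor ((adj G i u ∧ adj G w j) xor (adj G i w ∧ adj G u j))
pivot G u w .sym i j = cong₂ _xor_ (sym G i j)
  (trans (Bool.xor-comm (adj G i u ∧ adj G w j) _) (cong₂ _xor_ (adj-transpose G i w u j) (adj-transpose G i u w j)))
pivot G u w .irrefl i = trans
  (cong₂ _xor_ (irrefl G i) (cong ((adj G i u ∧ adj G w i) xor_) (adj-transpose G i w u i)))
  (Bool.xor-same (adj G i u ∧ adj G w i))

module _ {n} (G : Graph n) (W : Subset n) {u w : Fin n}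
         (u∈W : lookup W u ≡ true) (w∈W : lookup W w ≡ true) (uw : adj G u w ≡ true) where

  private
    A = adj G
    H = pivot G u w
    W′ = W [ u ]≔ false
    W″ = W′ [ w ]≔ false

    w≢u : w ≢ u
    w≢u refl with () ← trans (≡.sym uw) (irrefl G w)

    u≢w : u ≢ w
    u≢w = w≢u ∘ ≡.sym

    w∈W′ : lookup W′ w ≡ true
    w∈W′ = trans (lookup∘update′ w≢u W false) w∈W

    strip : Vec Bool n → Vec Bool n
    strip x = (x [ u ]≔ false) [ w ]≔ false

    a b : Vec Bool n → Bool
    a x = strip x · A u
    b x = strip x · A w

    strip-ignores-u : Ignores u strip
    strip-ignores-u x c = cong (_[ w ]≔ false) ([]≔-idempotent x u)

    strip-ignores-w : Ignores w strip
    strip-ignores-w x c = trans (cong (_[ w ]≔ false) ([]≔-commutes x w u w≢u)) ([]≔-idempotent (x [ u ]≔ false) w)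

    ·-strip : ∀ x g → x · g ≡ (lookup x u ∧ g u) xor ((lookup x w ∧ g w) xor (strip x · g))
    ·-strip x g = trans (·-at x g u) (cong ((lookup x u ∧ g u) xor_)
      (trans (·-at (x [ u ]≔ false) g w) (cong (λ c → (c ∧ g w) xor (strip x · g)) (lookup∘update′ w≢u x false))))

    row-u : ∀ x → not (x · A u) ≡ (lookup x w == a x)
    row-u x = cong not (begin
      x · A u
        ≡⟨ ·-strip x (A u) ⟩
      (lookup x u ∧ A u u) xor ((lookup x w ∧ A u w) xor a x)
        ≡⟨ cong₂ (λ p q → (lookup x u ∧ p) xor ((lookup x w ∧ q) xor a x)) (irrefl G u) uw ⟩
      (lookup x u ∧ false) xor ((lookup x w ∧ true) xor a x)
        ≡⟨ cong₂ (λ p q → p xor (q xor a x)) (Bool.∧-zeroʳ (lookup x u)) (Bool.∧-identityʳ (lookup x w)) ⟩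
      lookup x w xor a x ∎)
      where open ≡-Reasoning

    row-w : ∀ x → not (x · A w) ≡ (lookup x u == b x)
    row-w x = cong not (begin
      x · A w
        ≡⟨ ·-strip x (A w) ⟩
      (lookup x u ∧ A w u) xor ((lookup x w ∧ A w w) xor b x)
        ≡⟨ cong₂ (λ p q → (lookup x u ∧ p) xor ((lookup x w ∧ q) xor b x)) (trans (sym G w u) uw) (irrefl G w) ⟩
      (lookup x u ∧ true) xor ((lookup x w ∧ false) xor b x)
        ≡⟨ cong₂ (λ p q → p xor (q xor b x)) (Bool.∧-identityʳ (lookup x u)) (Bool.∧-zeroʳ (lookup x w)) ⟩
      lookup x u xor b x ∎)
      where open ≡-Reasoning

    row-pivot : ∀ x → lookup x u ≡ b x → lookup x w ≡ a x → ∀ i → x · A i ≡ strip x · adj H i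
    row-pivot x xu≡bx xw≡ax i = begin
      x · A i
        ≡⟨ ·-strip x (A i) ⟩
      (lookup x u ∧ A i u) xor ((lookup x w ∧ A i w) xor s·Aᵢ)
        ≡⟨ cong₂ (λ p q → (p ∧ A i u) xor ((q ∧ A i w) xor s·Aᵢ)) xu≡bx xw≡ax ⟩
      (b x ∧ A i u) xor ((a x ∧ A i w) xor s·Aᵢ)
        ≡⟨ Xor.x∙yz≈z∙yx (b x ∧ A i u) (a x ∧ A i w) s·Aᵢ ⟩
      s·Aᵢ xor ((a x ∧ A i w) xor (b x ∧ A i u))
        ≡⟨ cong (s·Aᵢ xor_) (Bool.xor-comm (a x ∧ A i w) (b x ∧ A i u)) ⟩
      s·Aᵢ xor ((b x ∧ A i u) xor (a x ∧ A i w))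
        ≡⟨ cong₂ (λ p q → s·Aᵢ xor (p xor q)) (Bool.∧-comm (b x) (A i u)) (Bool.∧-comm (a x) (A i w)) ⟩
      s·Aᵢ xor ((A i u ∧ b x) xor (A i w ∧ a x))
        ≡⟨ cong₂ (λ p q → s·Aᵢ xor (p xor q)) (·-scale (strip x) (A i u) (A w)) (·-scale (strip x) (A i w) (A u)) ⟨
      s·Aᵢ xor ((strip x · (λ j → A i u ∧ A w j)) xor (strip x · (λ j → A i w ∧ A u j)))
        ≡⟨ cong (s·Aᵢ xor_) (·-xor (strip x) (λ j → A i u ∧ A w j) (λ j → A i w ∧ A u j)) ⟨
      s·Aᵢ xor (strip x · (λ j → (A i u ∧ A w j) xor (A i w ∧ A u j)))
        ≡⟨ ·-xor (strip x) (A i) (λ j → (A i u ∧ A w j) xor (A i w ∧ A u j)) ⟨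
      strip x · adj H i ∎
      where
      open ≡-Reasoning
      s·Aᵢ = strip x · A i

    inKer-strip : ∀ x → inKer G W x ≡ (lookup x w == a x) ∧ ((lookup x u == b x) ∧ inKer H W″ (strip x))
    inKer-strip x = begin
      (x ⊆ᵇ W) ∧ allIn W φ
        ≡⟨ cong₂ _∧_ (trans (⊆ᵇ-remove x W u∈W) (⊆ᵇ-remove (x [ u ]≔ false) W′ w∈W′))
                     (trans (allIn-member W φ u∈W) (cong (φ u ∧_) (allIn-member W′ φ w∈W′))) ⟩
      s ∧ (φ u ∧ (φ w ∧ allIn W″ φ))
        ≡⟨ cong₂ (λ p q → s ∧ (p ∧ (q ∧ allIn W″ φ))) (row-u x) (row-w x) ⟩
      s ∧ (e₁ ∧ (e₂ ∧ allIn W″ φ))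
        ≡⟨ cong (s ∧_) (∧-congʳ-if e₁ λ h₁ → ∧-congʳ-if e₂ λ h₂ →
             allIn-cong W″ λ i _ → cong not (row-pivot x (==⇒≡ h₂) (==⇒≡ h₁) i)) ⟩
      s ∧ (e₁ ∧ (e₂ ∧ allIn W″ ψ))
        ≡⟨ trans (And.x∙yz≈y∙xz s e₁ _) (cong (e₁ ∧_) (And.x∙yz≈y∙xz s e₂ _)) ⟩
      e₁ ∧ (e₂ ∧ (s ∧ allIn W″ ψ)) ∎
      where
      open ≡-Reasoning
      s = strip x ⊆ᵇ W″
      e₁ = lookup x w == a x
      e₂ = lookup x u == b x
      φ ψ : Fin n → Bool
      φ i = not (x · A i)
      ψ i = not (strip x · adj H i)

  kerSize-pivot : kerSize G W ≡ kerSize H W″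
  kerSize-pivot = begin
    count n (inKer G W)
      ≡⟨ count-cong n inKer-strip ⟩
    count n (λ x → (lookup x w == a x) ∧ ((lookup x u == b x) ∧ R x))
      ≡⟨ count-solve-at w a _ a-ignores-w Q-ignores-w ⟩
    count n (λ x → not (lookup x w) ∧ ((lookup x u == b x) ∧ R x))
      ≡⟨ count-cong n (λ x → And.x∙yz≈y∙xz (not (lookup x w)) (lookup x u == b x) (R x)) ⟩
    count n (λ x → (lookup x u == b x) ∧ (not (lookup x w) ∧ R x))
      ≡⟨ count-solve-at u b _ b-ignores-u R′-ignores-u ⟩
    count n (λ x → not (lookup x u) ∧ (not (lookup x w) ∧ R x))
      ≡⟨ count-cong n reset ⟩
    count n (inKer H W″) ∎
    where
    open ≡-Reasoning
    R : Vec Bool n → Bool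
    R x = inKer H W″ (strip x)
    a-ignores-w : Ignores w a
    a-ignores-w x c = cong (_· A u) (strip-ignores-w x c)
    Q-ignores-w : Ignores w (λ x → (lookup x u == b x) ∧ R x)
    Q-ignores-w x c = cong₂ (λ p y → (p == y · A w) ∧ inKer H W″ y) (lookup∘update′ u≢w x c) (strip-ignores-w x c)
    b-ignores-u : Ignores u b
    b-ignores-u x c = cong (_· A w) (strip-ignores-u x c)
    R′-ignores-u : Ignores u (λ x → not (lookup x w) ∧ R x)
    R′-ignores-u x c = cong₂ (λ p y → not p ∧ inKer H W″ y) (lookup∘update′ w≢u x c) (strip-ignores-u x c)
    reset : ∀ x → not (lookup x u) ∧ (not (lookup x w) ∧ R x) ≡ inKer H W″ x
    reset x = begin
      not (lookup x u) ∧ (not (lookup x w) ∧ R x)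
        ≡⟨ cong (λ p → not (lookup x u) ∧ (not p ∧ R x)) (lookup∘update′ w≢u x false) ⟨
      not (lookup x u) ∧ (not (lookup y w) ∧ inKer H W″ (y [ w ]≔ false))
        ≡⟨ cong (not (lookup x u) ∧_) (not∧-reset (inKer-outside H W″ (lookup∘update w W′ false)) y) ⟩
      not (lookup x u) ∧ inKer H W″ y
        ≡⟨ not∧-reset (inKer-outside H W″ (trans (lookup∘update′ u≢w W′ false) (lookup∘update u W false))) x ⟩
      inKer H W″ x ∎
      where y = x [ u ]≔ false

  ∣W∣≡2+∣W″∣ : ∣ W ∣ ≡ 2 + ∣ W″ ∣
  ∣W∣≡2+∣W″∣ = trans (∣[]≔false∣ W u∈W) (cong suc (∣[]≔false∣ W′ w∈W′))

  kernelDimension-pivot : KernelDimension H W″ → KernelDimension G W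
  kernelDimension-pivot d = record
    { dim           = dim
    ; kerSize≡2^dim = trans kerSize-pivot kerSize≡2^dim
    ; dim-parity    = begin
        -1ℤ ^ℤ dim                     ≡⟨ dim-parity ⟩
        -1ℤ ^ℤ ∣ W″ ∣                  ≡⟨ IntP.neg-involutive _ ⟨
        - - (-1ℤ ^ℤ ∣ W″ ∣)            ≡⟨ trans (-1^suc (suc ∣ W″ ∣)) (cong -_ (-1^suc ∣ W″ ∣)) ⟨
        -1ℤ ^ℤ (2 + ∣ W″ ∣)            ≡⟨ cong (-1ℤ ^ℤ_) ∣W∣≡2+∣W″∣ ⟨
        -1ℤ ^ℤ ∣ W ∣                   ∎
    }
    where
    open KernelDimension d
    open ≡-Reasoning

kernelDimension-bounded : ∀ f {n} (G : Graph n) W → ∣ W ∣ ≤ f → KernelDimension G W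
kernelDimension-bounded f G W ∣W∣≤f with nonempty? W
... | no W-empty = subst (KernelDimension G) (≡.sym (Empty-unique W-empty)) (kernelDimension-⊥ G)
kernelDimension-bounded zero G W ∣W∣≤0 | yes (u , u∈W)
  with () ← subst (_≤ 0) (∣[]≔false∣ W ([]=⇒lookup u∈W)) ∣W∣≤0
kernelDimension-bounded (suc f) G W ∣W∣≤1+f | yes (u , u∈W)
  with any? (λ w → (lookup W w Bool.≟ true) ×-dec (adj G u w Bool.≟ true))
... | no no-neighbour = kernelDimension-isolated G W u∈W′ isolated
        (kernelDimension-bounded f G (W [ u ]≔ false) (NatP.≤-pred (subst (_≤ suc f) (∣[]≔false∣ W u∈W′) ∣W∣≤1+f)))
  where
  u∈W′ = []=⇒lookup u∈W
  isolated : ∀ w → lookup W w ≡ true → adj G u w ≡ false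
  isolated w w∈W = Bool.¬-not (λ uw → no-neighbour (w , w∈W , uw))
... | yes (w , w∈W , uw) = kernelDimension-pivot G W u∈W′ w∈W uw
        (kernelDimension-bounded f (pivot G u w) _ (NatP.≤-trans (NatP.n≤1+n _)
          (NatP.≤-pred (subst (_≤ suc f) (∣W∣≡2+∣W″∣ G W u∈W′ w∈W uw) ∣W∣≤1+f))))
  where u∈W′ = []=⇒lookup u∈W

kernelDimension : ∀ {n} (G : Graph n) W → KernelDimension G W
kernelDimension G W = kernelDimension-bounded ∣ W ∣ G W NatP.≤-refl

-- γ as a sum over vertex subsets

open SubsetSum IntP.+-0-commutativeMonoid using (∑; unless; unless-cong; ∑-cong; ∑-ε; ∑-∙; ∑-pair-at)

coeff-⊕ : ∀ p q k → coeff (p ⊕ q) k ≡ coeff p k +ℤ coeff q k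
coeff-⊕ []      q       k       = ≡.sym (IntP.+-identityˡ (coeff q k))
coeff-⊕ (a ∷ p) []      k       = ≡.sym (IntP.+-identityʳ (coeff (a ∷ p) k))
coeff-⊕ (a ∷ p) (b ∷ q) zero    = refl
coeff-⊕ (a ∷ p) (b ∷ q) (suc k) = coeff-⊕ p q k

coeff-scale : ∀ c q k → coeff (scale c q) k ≡ c * coeff q k
coeff-scale c []      k       = ≡.sym (IntP.*-zeroʳ c)
coeff-scale c (a ∷ q) zero    = refl
coeff-scale c (a ∷ q) (suc k) = coeff-scale c q k

coeff-sumPoly-++ : ∀ ps qs k → coeff (sumPoly (ps ++ qs)) k ≡ coeff (sumPoly ps) k +ℤ coeff (sumPoly qs) k
coeff-sumPoly-++ []       qs k = ≡.sym (IntP.+-identityˡ _)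
coeff-sumPoly-++ (p ∷ ps) qs k = begin
  coeff (p ⊕ sumPoly (ps ++ qs)) k
    ≡⟨ coeff-⊕ p (sumPoly (ps ++ qs)) k ⟩
  coeff p k +ℤ coeff (sumPoly (ps ++ qs)) k
    ≡⟨ cong (coeff p k +ℤ_) (coeff-sumPoly-++ ps qs k) ⟩
  coeff p k +ℤ (coeff (sumPoly ps) k +ℤ coeff (sumPoly qs) k)
    ≡⟨ IntP.+-assoc (coeff p k) _ _ ⟨
  (coeff p k +ℤ coeff (sumPoly ps) k) +ℤ coeff (sumPoly qs) k
    ≡⟨ cong (_+ℤ coeff (sumPoly qs) k) (coeff-⊕ p (sumPoly ps) k) ⟨
  coeff (p ⊕ sumPoly ps) k +ℤ coeff (sumPoly qs) k ∎
  where open ≡-Reasoning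

coeff-sumPoly-allVecs : ∀ n (F : Vec Bool n → Poly) k → coeff (sumPoly (map F (allVecs n))) k ≡ ∑ n (λ W → coeff (F W) k)
coeff-sumPoly-allVecs zero    F k = trans (coeff-⊕ (F []) [] k) (IntP.+-identityʳ _)
coeff-sumPoly-allVecs (suc n) F k = begin
  coeff (sumPoly (map F (map (false ∷_) vs ++ map (true ∷_) vs))) k
    ≡⟨ cong (λ ps → coeff (sumPoly ps) k) (List.map-++ F (map (false ∷_) vs) _) ⟩
  coeff (sumPoly (map F (map (false ∷_) vs) ++ map F (map (true ∷_) vs))) k
    ≡⟨ coeff-sumPoly-++ (map F (map (false ∷_) vs)) _ k ⟩
  coeff (sumPoly (map F (map (false ∷_) vs))) k +ℤ coeff (sumPoly (map F (map (true ∷_) vs))) k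
    ≡⟨ cong₂ _+ℤ_ (cong (λ ps → coeff (sumPoly ps) k) (List.map-∘ vs)) (cong (λ ps → coeff (sumPoly ps) k) (List.map-∘ vs)) ⟨
  coeff (sumPoly (map (F ∘ (false ∷_)) vs)) k +ℤ coeff (sumPoly (map (F ∘ (true ∷_)) vs)) k
    ≡⟨ cong₂ _+ℤ_ (coeff-sumPoly-allVecs n (F ∘ (false ∷_)) k) (coeff-sumPoly-allVecs n (F ∘ (true ∷_)) k) ⟩
  ∑ (suc n) (λ W → coeff (F W) k) ∎
  where
  open ≡-Reasoning
  vs = allVecs n

c₀ c₁ : ℕ → ℤ
c₀ k = coeff (pow xMinus1 k) 0
c₁ k = coeff (pow xMinus1 k) 1

γ≡∑c₁ν : ∀ {n} (G : Graph n) → γ G ≡ ∑ n (λ W → c₁ (ν G W))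
γ≡∑c₁ν {n} G = coeff-sumPoly-allVecs n (λ W → pow xMinus1 (ν G W)) 1

c₀-suc : ∀ k → c₀ (suc k) ≡ - c₀ k
c₀-suc k = begin
  coeff (scale -1ℤ P ⊕ (0ℤ ∷ (scale 1ℤ P ⊕ (0ℤ ∷ [])))) 0  ≡⟨ coeff-⊕ (scale -1ℤ P) _ 0 ⟩
  coeff (scale -1ℤ P) 0 +ℤ 0ℤ                             ≡⟨ IntP.+-identityʳ _ ⟩
  coeff (scale -1ℤ P) 0                                   ≡⟨ coeff-scale -1ℤ P 0 ⟩
  -1ℤ * c₀ k                                              ≡⟨ IntP.-1*i≡-i (c₀ k) ⟩
  - c₀ k                                                  ∎
  where
  open ≡-Reasoning
  P = pow xMinus1 k

c₁-suc : ∀ k → c₁ (suc k) ≡ - c₁ k +ℤ c₀ k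
c₁-suc k = begin
  coeff (scale -1ℤ P ⊕ (0ℤ ∷ (scale 1ℤ P ⊕ (0ℤ ∷ [])))) 1
    ≡⟨ coeff-⊕ (scale -1ℤ P) _ 1 ⟩
  coeff (scale -1ℤ P) 1 +ℤ coeff (scale 1ℤ P ⊕ (0ℤ ∷ [])) 0
    ≡⟨ cong₂ _+ℤ_ (coeff-scale -1ℤ P 1) (coeff-⊕ (scale 1ℤ P) _ 0) ⟩
  -1ℤ * c₁ k +ℤ (coeff (scale 1ℤ P) 0 +ℤ 0ℤ)
    ≡⟨ cong₂ _+ℤ_ (IntP.-1*i≡-i (c₁ k)) (IntP.+-identityʳ _) ⟩
  - c₁ k +ℤ coeff (scale 1ℤ P) 0
    ≡⟨ cong (- c₁ k +ℤ_) (trans (coeff-scale 1ℤ P 0) (IntP.*-identityˡ (c₀ k))) ⟩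
  - c₁ k +ℤ c₀ k ∎
  where
  open ≡-Reasoning
  P = pow xMinus1 k

c₀≡-1^ : ∀ k → c₀ k ≡ -1ℤ ^ℤ k
c₀≡-1^ zero    = refl
c₀≡-1^ (suc k) = trans (c₀-suc k) (trans (cong -_ (c₀≡-1^ k)) (≡.sym (-1^suc k)))

c₁-pair : ∀ k → c₁ k +ℤ c₁ (suc k) ≡ -1ℤ ^ℤ k
c₁-pair k = begin
  c₁ k +ℤ c₁ (suc k)          ≡⟨ cong (c₁ k +ℤ_) (c₁-suc k) ⟩
  c₁ k +ℤ (- c₁ k +ℤ c₀ k)    ≡⟨ IntP.+-assoc (c₁ k) (- c₁ k) (c₀ k) ⟨
  (c₁ k +ℤ - c₁ k) +ℤ c₀ k    ≡⟨ cong (_+ℤ c₀ k) (IntP.+-inverseʳ (c₁ k)) ⟩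
  0ℤ +ℤ c₀ k                  ≡⟨ IntP.+-identityˡ (c₀ k) ⟩
  c₀ k                        ≡⟨ c₀≡-1^ k ⟩
  -1ℤ ^ℤ k                    ∎
  where open ≡-Reasoning

ν-cong : ∀ {m n} (G′ : Graph m) W′ (G : Graph n) W → kerSize G′ W′ ≡ kerSize G W → ν G′ W′ ≡ ν G W
ν-cong G′ W′ G W e = trans (ν≡log₂kerSize G′ W′) (trans (cong ⌊log₂_⌋ e) (≡.sym (ν≡log₂kerSize G W)))

ν≡dim : ∀ {n} (G : Graph n) W → ν G W ≡ KernelDimension.dim (kernelDimension G W)
ν≡dim G W = trans (ν≡log₂kerSize G W) (trans (cong ⌊log₂_⌋ kerSize≡2^dim) (⌊log₂[2^n]⌋≡n dim))
  where open KernelDimension (kernelDimension G W)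

ν-double : ∀ {m n} (G′ : Graph m) W′ (G : Graph n) W → kerSize G′ W′ ≡ kerSize G W + kerSize G W → ν G′ W′ ≡ suc (ν G W)
ν-double G′ W′ G W e = begin
  ν G′ W′                          ≡⟨ ν≡log₂kerSize G′ W′ ⟩
  ⌊log₂ kerSize G′ W′ ⌋            ≡⟨ cong ⌊log₂_⌋ (trans e (cong₂ _+_ kerSize≡2^dim kerSize≡2^dim)) ⟩
  ⌊log₂ (2 ^ dim + 2 ^ dim) ⌋      ≡⟨ cong (λ k → ⌊log₂ (2 ^ dim + k) ⌋) (NatP.+-identityʳ (2 ^ dim)) ⟨
  ⌊log₂ (2 ^ suc dim) ⌋            ≡⟨ ⌊log₂[2^n]⌋≡n (suc dim) ⟩
  suc dim                          ≡⟨ cong suc (ν≡dim G W) ⟨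
  suc (ν G W)                      ∎
  where
  open ≡-Reasoning
  open KernelDimension (kernelDimension G W)

c₁-pair-ν : ∀ {n} (G : Graph n) W → c₁ (ν G W) +ℤ c₁ (suc (ν G W)) ≡ -1ℤ ^ℤ ∣ W ∣
c₁-pair-ν G W = trans (c₁-pair (ν G W)) (trans (cong (-1ℤ ^ℤ_) (ν≡dim G W)) dim-parity)
  where open KernelDimension (kernelDimension G W)

-- Adding a vertex

inKer-extend : ∀ {n} (G : Graph n) N W c x →
  inKer (extend G N) (true ∷ W) (c ∷ x) ≡ (x ⊆ᵇ W) ∧ (not (x · N) ∧ allIn W (λ i → not ((c ∧ N i) xor (x · adj G i))))
inKer-extend G N W false x = refl
inKer-extend G N W true  x = refl

kerSize-extend-outside : ∀ {n} (G : Graph n) N W → kerSize (extend G N) (false ∷ W) ≡ kerSize G W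
kerSize-extend-outside {n} G N W = trans (cong (_+_ (kerSize G W)) (ℕ-Sum.∑-ε n)) (NatP.+-identityʳ (kerSize G W))

module _ {n} (G : Graph n) (W : Subset n) {v : Fin n} (v∉W : lookup W v ≡ false) where

  private
    A = adj G
    W⁺ = W [ v ]≔ true

    e : Fin n → Bool
    e j = ⌊ j ≟ v ⌋

    e-outside : ∀ i → lookup W i ≡ true → e i ≡ false
    e-outside i i∈W = ⌊≟⌋-≢ (∈∉⇒≢ W i∈W v∉W)

    rows-outside : ∀ c x → allIn W (λ i → not ((c ∧ e i) xor (x · A i))) ≡ allIn W (λ i → not (x · A i))
    rows-outside c x = allIn-cong W λ i i∈W →
      cong (λ b → not (b xor (x · A i))) (trans (cong (c ∧_) (e-outside i i∈W)) (Bool.∧-zeroʳ c))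

    inKer-pendant-new : ∀ c x → inKer (addPendant G v) (true ∷ W) (c ∷ x) ≡ inKer G W x
    inKer-pendant-new c x = trans (inKer-extend G e W c x) (∧-congʳ-if (x ⊆ᵇ W) λ x⊆W →
      cong₂ _∧_ (cong not (trans (·-indicator x v) (⊆ᵇ⇒∉ x W x⊆W v∉W))) (rows-outside c x))

    inKer-pendant-both : ∀ c x → inKer (addPendant G v) (true ∷ W⁺) (c ∷ x) ≡ (c == x · A v) ∧ inKer G W x
    inKer-pendant-both c x = begin
      inKer (addPendant G v) (true ∷ W⁺) (c ∷ x)
        ≡⟨ inKer-extend G e W⁺ c x ⟩
      (x ⊆ᵇ W⁺) ∧ (not (x · e) ∧ allIn W⁺ ρ)
        ≡⟨ cong₂ (λ p q → (x ⊆ᵇ W⁺) ∧ (not p ∧ q)) (·-indicator x v) (allIn-insert W ρ v∉W) ⟩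
      (x ⊆ᵇ W⁺) ∧ (not (lookup x v) ∧ (ρ v ∧ allIn W ρ))
        ≡⟨ cong₂ (λ p q → (x ⊆ᵇ W⁺) ∧ (not (lookup x v) ∧ (not ((c ∧ p) xor (x · A v)) ∧ q)))
                 (⌊≟⌋-refl v) (rows-outside c x) ⟩
      (x ⊆ᵇ W⁺) ∧ (not (lookup x v) ∧ (not ((c ∧ true) xor (x · A v)) ∧ allIn W φ))
        ≡⟨ cong (λ p → (x ⊆ᵇ W⁺) ∧ (not (lookup x v) ∧ (not (p xor (x · A v)) ∧ allIn W φ))) (Bool.∧-identityʳ c) ⟩
      (x ⊆ᵇ W⁺) ∧ (not (lookup x v) ∧ ((c == x · A v) ∧ allIn W φ))
        ≡⟨ Bool.∧-assoc (x ⊆ᵇ W⁺) (not (lookup x v)) _ ⟨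
      ((x ⊆ᵇ W⁺) ∧ not (lookup x v)) ∧ ((c == x · A v) ∧ allIn W φ)
        ≡⟨ And.x∙yz≈y∙xz ((x ⊆ᵇ W⁺) ∧ not (lookup x v)) (c == x · A v) (allIn W φ) ⟩
      (c == x · A v) ∧ (((x ⊆ᵇ W⁺) ∧ not (lookup x v)) ∧ allIn W φ)
        ≡⟨ cong (λ s → (c == x · A v) ∧ (s ∧ allIn W φ)) ⊆ᵇ-split ⟩
      (c == x · A v) ∧ inKer G W x ∎
      where
      open ≡-Reasoning
      ρ φ : Fin n → Bool
      ρ i = not ((c ∧ e i) xor (x · A i))
      φ i = not (x · A i)
      ⊆ᵇ-split : (x ⊆ᵇ W⁺) ∧ not (lookup x v) ≡ x ⊆ᵇ W
      ⊆ᵇ-split = ≡.sym (trans (⊆ᵇ-avoid x W v∉W)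
        (trans (cong (not (lookup x v) ∧_) (≡.sym (⊆ᵇ-insert x W v))) (Bool.∧-comm (not (lookup x v)) (x ⊆ᵇ W⁺))))

  kerSize-pendant-new : kerSize (addPendant G v) (true ∷ W) ≡ kerSize G W + kerSize G W
  kerSize-pendant-new = cong₂ _+_ (count-cong n (inKer-pendant-new false)) (count-cong n (inKer-pendant-new true))

  kerSize-pendant-both : kerSize (addPendant G v) (true ∷ W⁺) ≡ kerSize G W
  kerSize-pendant-both = trans (cong₂ _+_ (count-cong n (inKer-pendant-both false)) (count-cong n (inKer-pendant-both true)))
                               (≡.sym (count-fibres n (inKer G W) (_· A v)))

  private
    inKer-falseTwin-new : ∀ c x → inKer (addFalseTwin G v) (true ∷ W) (c ∷ x) ≡ not (lookup x v) ∧ inKer G W⁺ (x [ v ]≔ c)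
    inKer-falseTwin-new c x = begin
      inKer (addFalseTwin G v) (true ∷ W) (c ∷ x)
        ≡⟨ inKer-extend G (A v) W c x ⟩
      (x ⊆ᵇ W) ∧ (not (x · A v) ∧ allIn W ρ)
        ≡⟨ cong (_∧ (not (x · A v) ∧ allIn W ρ)) (⊆ᵇ-avoid x W v∉W) ⟩
      (not (lookup x v) ∧ (x [ v ]≔ false ⊆ᵇ W)) ∧ (not (x · A v) ∧ allIn W ρ)
        ≡⟨ Bool.∧-assoc (not (lookup x v)) _ _ ⟩
      not (lookup x v) ∧ ((x [ v ]≔ false ⊆ᵇ W) ∧ (not (x · A v) ∧ allIn W ρ))
        ≡⟨ not∧-congʳ-if (lookup x v) (λ xᵥ →
             cong₂ _∧_ ⊆ᵇ-y (cong₂ _∧_ (cong not ·-y) (allIn-cong W λ i _ → cong not (row i xᵥ)))) ⟩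
      not (lookup x v) ∧ ((y [ v ]≔ false ⊆ᵇ W) ∧ (not (y · A v) ∧ allIn W χ))
        ≡⟨ cong (not (lookup x v) ∧_) (cong₂ _∧_ (⊆ᵇ-insert y W v) (allIn-insert W χ v∉W)) ⟨
      not (lookup x v) ∧ inKer G W⁺ y ∎
      where
      open ≡-Reasoning
      y = x [ v ]≔ c
      ρ χ : Fin n → Bool
      ρ i = not ((c ∧ A v i) xor (x · A i))
      χ i = not (y · A i)
      ⊆ᵇ-y : x [ v ]≔ false ⊆ᵇ W ≡ y [ v ]≔ false ⊆ᵇ W
      ⊆ᵇ-y = cong (_⊆ᵇ W) (≡.sym ([]≔-idempotent x v))
      ·-y : x · A v ≡ y · A v
      ·-y = ≡.sym (·-[]≔-irrelevant x c (irrefl G v))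
      row : ∀ i → lookup x v ≡ false → (c ∧ A v i) xor (x · A i) ≡ y · A i
      row i xᵥ = ≡.sym (trans (·-[]≔ x (A i) v c) (cong₂ (λ p z → (c ∧ p) xor (z · A i)) (sym G i v) ([]≔-unchanged x xᵥ)))

    inKer-falseTwin-both : ∀ c x → inKer (addFalseTwin G v) (true ∷ W⁺) (c ∷ x) ≡ inKer G W⁺ (x [ v ]≔ (lookup x v xor c))
    inKer-falseTwin-both c x = begin
      inKer (addFalseTwin G v) (true ∷ W⁺) (c ∷ x)
        ≡⟨ inKer-extend G (A v) W⁺ c x ⟩
      (x ⊆ᵇ W⁺) ∧ (not (x · A v) ∧ allIn W⁺ ρ)
        ≡⟨ cong (λ q → (x ⊆ᵇ W⁺) ∧ (not (x · A v) ∧ q)) (allIn-insert W ρ v∉W) ⟩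
      (x ⊆ᵇ W⁺) ∧ (not (x · A v) ∧ (ρ v ∧ allIn W ρ))
        ≡⟨ cong (λ p → (x ⊆ᵇ W⁺) ∧ (not (x · A v) ∧ (not (p xor (x · A v)) ∧ allIn W ρ)))
                (trans (cong (c ∧_) (irrefl G v)) (Bool.∧-zeroʳ c)) ⟩
      (x ⊆ᵇ W⁺) ∧ (not (x · A v) ∧ (not (x · A v) ∧ allIn W ρ))
        ≡⟨ cong ((x ⊆ᵇ W⁺) ∧_) (trans (≡.sym (Bool.∧-assoc (not (x · A v)) _ _)) (cong (_∧ allIn W ρ) (Bool.∧-idem _))) ⟩
      (x ⊆ᵇ W⁺) ∧ (not (x · A v) ∧ allIn W ρ)
        ≡⟨ cong₂ (λ s p → s ∧ (not p ∧ allIn W ρ)) ⊆ᵇ-y (≡.sym (·-[]≔-irrelevant x t (irrefl G v))) ⟩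
      (y ⊆ᵇ W⁺) ∧ (not (y · A v) ∧ allIn W ρ)
        ≡⟨ cong (λ q → (y ⊆ᵇ W⁺) ∧ (not (y · A v) ∧ q)) (allIn-cong W λ i _ → cong not (row i)) ⟩
      (y ⊆ᵇ W⁺) ∧ (not (y · A v) ∧ allIn W χ)
        ≡⟨ cong ((y ⊆ᵇ W⁺) ∧_) (allIn-insert W χ v∉W) ⟨
      inKer G W⁺ y ∎
      where
      open ≡-Reasoning
      t = lookup x v xor c
      y = x [ v ]≔ t
      ρ χ : Fin n → Bool
      ρ i = not ((c ∧ A v i) xor (x · A i))
      χ i = not (y · A i)
      ⊆ᵇ-y : x ⊆ᵇ W⁺ ≡ y ⊆ᵇ W⁺
      ⊆ᵇ-y = trans (⊆ᵇ-insert x W v) (≡.sym (trans (⊆ᵇ-insert y W v) (cong (_⊆ᵇ W) ([]≔-idempotent x v))))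
      row : ∀ i → (c ∧ A v i) xor (x · A i) ≡ y · A i
      row i = begin
        (c ∧ A v i) xor (x · A i)
          ≡⟨ cong₂ (λ p q → (c ∧ p) xor q) (sym G v i) (·-at x (A i) v) ⟩
        (c ∧ A i v) xor ((lookup x v ∧ A i v) xor ((x [ v ]≔ false) · A i))
          ≡⟨ Xor.x∙yz≈yx∙z (c ∧ A i v) (lookup x v ∧ A i v) _ ⟩
        ((lookup x v ∧ A i v) xor (c ∧ A i v)) xor ((x [ v ]≔ false) · A i)
          ≡⟨ cong (_xor ((x [ v ]≔ false) · A i)) (Bool.∧-distribʳ-xor (A i v) (lookup x v) c) ⟨
        (t ∧ A i v) xor ((x [ v ]≔ false) · A i)
          ≡⟨ ·-[]≔ x (A i) v t ⟨
        y · A i ∎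

  kerSize-falseTwin-new : kerSize (addFalseTwin G v) (true ∷ W) ≡ kerSize G W⁺
  kerSize-falseTwin-new = begin
    count n (λ x → inKer G″ (true ∷ W) (false ∷ x)) + count n (λ x → inKer G″ (true ∷ W) (true ∷ x))
      ≡⟨ cong₂ _+_ (trans (count-cong n (inKer-falseTwin-new false)) (count-cong n reset))
                   (count-cong n (inKer-falseTwin-new true)) ⟩
    count n (λ x → not (lookup x v) ∧ K x) + count n (λ x → not (lookup x v) ∧ K (x [ v ]≔ true))
      ≡⟨ count-pair-at v K ⟨
    count n K ∎
    where
    open ≡-Reasoning
    G″ = addFalseTwin G v
    K = inKer G W⁺
    reset : ∀ x → not (lookup x v) ∧ K (x [ v ]≔ false) ≡ not (lookup x v) ∧ K x
    reset x = not∧-congʳ-if (lookup x v) (λ xᵥ → cong K ([]≔-unchanged x xᵥ))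

  kerSize-falseTwin-both : kerSize (addFalseTwin G v) (true ∷ W⁺) ≡ kerSize G W⁺ + kerSize G W⁺
  kerSize-falseTwin-both = cong₂ _+_
    (trans (count-cong n (inKer-falseTwin-both false)) (count-cong n λ x →
      cong K (trans (cong (x [ v ]≔_) (Bool.xor-identityʳ (lookup x v))) ([]≔-lookup x v))))
    (trans (count-cong n (inKer-falseTwin-both true)) (trans (count-cong n λ x →
      cong (λ b → K (x [ v ]≔ b)) (trans (Bool.xor-comm (lookup x v) true) (Bool.true-xor (lookup x v))))
      (count-toggle-at v K)))
    where K = inKer G W⁺

  private
    N : Fin n → Bool
    N j = A v j ∨ ⌊ j ≟ v ⌋

    N≡A+e : ∀ j → N j ≡ A v j xor e j
    N≡A+e j with j ≟ v
    ... | yes refl = trans (Bool.∨-zeroʳ (A j j)) (≡.sym (cong (_xor true) (irrefl G j)))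
    ... | no  _    = trans (Bool.∨-identityʳ (A v j)) (≡.sym (Bool.xor-identityʳ (A v j)))

    N-outside : ∀ i → lookup W i ≡ true → N i ≡ A v i
    N-outside i i∈W = trans (cong (A v i ∨_) (e-outside i i∈W)) (Bool.∨-identityʳ (A v i))

    N-v : N v ≡ true
    N-v = trans (cong (A v v ∨_) (⌊≟⌋-refl v)) (Bool.∨-zeroʳ (A v v))

    ·-N : ∀ x → x · N ≡ (x · A v) xor lookup x v
    ·-N x = trans (·-cong x N≡A+e) (trans (·-xor x (A v) e) (cong ((x · A v) xor_) (·-indicator x v)))

    inKer-trueTwin-new : ∀ c x → inKer (addTrueTwin G v) (true ∷ W) (c ∷ x) ≡ inKer (addFalseTwin G v) (true ∷ W) (c ∷ x)
    inKer-trueTwin-new c x = begin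
      inKer (addTrueTwin G v) (true ∷ W) (c ∷ x)
        ≡⟨ inKer-extend G N W c x ⟩
      (x ⊆ᵇ W) ∧ (not (x · N) ∧ allIn W (λ i → not ((c ∧ N i) xor (x · A i))))
        ≡⟨ ∧-congʳ-if (x ⊆ᵇ W) (λ x⊆W → cong₂ _∧_ (cong not (·-N-inside x⊆W))
             (allIn-cong W λ i i∈W → cong (λ b → not ((c ∧ b) xor (x · A i))) (N-outside i i∈W))) ⟩
      (x ⊆ᵇ W) ∧ (not (x · A v) ∧ allIn W (λ i → not ((c ∧ A v i) xor (x · A i))))
        ≡⟨ inKer-extend G (A v) W c x ⟨
      inKer (addFalseTwin G v) (true ∷ W) (c ∷ x) ∎
      where
      open ≡-Reasoning
      ·-N-inside : x ⊆ᵇ W ≡ true → x · N ≡ x · A v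
      ·-N-inside x⊆W = trans (·-N x) (trans (cong ((x · A v) xor_) (⊆ᵇ⇒∉ x W x⊆W v∉W)) (Bool.xor-identityʳ (x · A v)))

    neighbourSum : Vec Bool n → Bool
    neighbourSum x = (x [ v ]≔ false) · A v

    inKer-trueTwin-both : ∀ c x → inKer (addTrueTwin G v) (true ∷ W⁺) (c ∷ x) ≡
                                  (c == neighbourSum x) ∧ ((lookup x v == neighbourSum x) ∧ inKer G W (x [ v ]≔ false))
    inKer-trueTwin-both c x = begin
      inKer (addTrueTwin G v) (true ∷ W⁺) (c ∷ x)
        ≡⟨ inKer-extend G N W⁺ c x ⟩
      (x ⊆ᵇ W⁺) ∧ (not (x · N) ∧ allIn W⁺ ρ)
        ≡⟨ cong₂ _∧_ (⊆ᵇ-insert x W v) (cong₂ _∧_ (cong not ·-N′) (allIn-insert W ρ v∉W)) ⟩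
      (x′ ⊆ᵇ W) ∧ ((lookup x v == neighbourSum x) ∧ (ρ v ∧ allIn W ρ))
        ≡⟨ cong (λ p → (x′ ⊆ᵇ W) ∧ ((lookup x v == neighbourSum x) ∧ (p ∧ allIn W ρ))) ρ-v ⟩
      (x′ ⊆ᵇ W) ∧ ((lookup x v == neighbourSum x) ∧ ((c == neighbourSum x) ∧ allIn W ρ))
        ≡⟨ cong ((x′ ⊆ᵇ W) ∧_) (∧-congʳ-if (lookup x v == neighbourSum x) λ h₁ → ∧-congʳ-if (c == neighbourSum x) λ h₂ →
             allIn-cong W λ i i∈W → cong not (row i i∈W (trans (==⇒≡ h₂) (≡.sym (==⇒≡ h₁))))) ⟩
      (x′ ⊆ᵇ W) ∧ ((lookup x v == neighbourSum x) ∧ ((c == neighbourSum x) ∧ allIn W φ′))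
        ≡⟨ And.x∙yz≈y∙xz (x′ ⊆ᵇ W) (lookup x v == neighbourSum x) _ ⟩
      (lookup x v == neighbourSum x) ∧ ((x′ ⊆ᵇ W) ∧ ((c == neighbourSum x) ∧ allIn W φ′))
        ≡⟨ cong ((lookup x v == neighbourSum x) ∧_) (And.x∙yz≈y∙xz (x′ ⊆ᵇ W) (c == neighbourSum x) (allIn W φ′)) ⟩
      (lookup x v == neighbourSum x) ∧ ((c == neighbourSum x) ∧ inKer G W x′)
        ≡⟨ And.x∙yz≈y∙xz (lookup x v == neighbourSum x) (c == neighbourSum x) _ ⟩
      (c == neighbourSum x) ∧ ((lookup x v == neighbourSum x) ∧ inKer G W x′) ∎
      where
      open ≡-Reasoning
      x′ = x [ v ]≔ false
      ρ φ′ : Fin n → Bool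
      ρ  i = not ((c ∧ N i) xor (x · A i))
      φ′ i = not (x′ · A i)
      ·-Av : x · A v ≡ neighbourSum x
      ·-Av = ≡.sym (·-[]≔-irrelevant x false (irrefl G v))
      ·-N′ : x · N ≡ lookup x v xor neighbourSum x
      ·-N′ = trans (·-N x) (trans (cong (_xor lookup x v) ·-Av) (Bool.xor-comm (neighbourSum x) (lookup x v)))
      ρ-v : ρ v ≡ (c == neighbourSum x)
      ρ-v = cong₂ (λ p q → not (p xor q)) (trans (cong (c ∧_) N-v) (Bool.∧-identityʳ c)) ·-Av
      row : ∀ i → lookup W i ≡ true → c ≡ lookup x v → (c ∧ N i) xor (x · A i) ≡ x′ · A i
      row i i∈W c≡xᵥ = begin
        (c ∧ N i) xor (x · A i)
          ≡⟨ cong₂ (λ p q → (c ∧ p) xor q) (trans (N-outside i i∈W) (sym G v i)) (·-at x (A i) v) ⟩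
        (c ∧ A i v) xor ((lookup x v ∧ A i v) xor (x′ · A i))
          ≡⟨ cong (λ b → (b ∧ A i v) xor ((lookup x v ∧ A i v) xor (x′ · A i))) c≡xᵥ ⟩
        (lookup x v ∧ A i v) xor ((lookup x v ∧ A i v) xor (x′ · A i))
          ≡⟨ xor-cancelˡ (lookup x v ∧ A i v) (x′ · A i) ⟩
        x′ · A i ∎

  kerSize-trueTwin-new : kerSize (addTrueTwin G v) (true ∷ W) ≡ kerSize G W⁺
  kerSize-trueTwin-new = trans (cong₂ _+_ (count-cong n (inKer-trueTwin-new false)) (count-cong n (inKer-trueTwin-new true)))
                               kerSize-falseTwin-new

  kerSize-trueTwin-both : kerSize (addTrueTwin G v) (true ∷ W⁺) ≡ kerSize G W
  kerSize-trueTwin-both = begin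
    kerSize (addTrueTwin G v) (true ∷ W⁺)
      ≡⟨ cong₂ _+_ (count-cong n (inKer-trueTwin-both false)) (count-cong n (inKer-trueTwin-both true)) ⟩
    count n (λ x → (false == neighbourSum x) ∧ P x) + count n (λ x → (true == neighbourSum x) ∧ P x)
      ≡⟨ count-fibres n P neighbourSum ⟨
    count n P
      ≡⟨ count-solve-at v neighbourSum (K ∘ (_[ v ]≔ false))
           (λ x c → cong (_· A v) ([]≔-idempotent x v)) (λ x c → cong K ([]≔-idempotent x v)) ⟩
    count n (λ x → not (lookup x v) ∧ K (x [ v ]≔ false))
      ≡⟨ count-cong n (not∧-reset (inKer-outside G W v∉W)) ⟩
    count n K ∎
    where
    open ≡-Reasoning
    K = inKer G W
    P : Vec Bool n → Bool
    P x = (lookup x v == neighbourSum x) ∧ K (x [ v ]≔ false)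

unless-neg : ∀ b z → unless b (- z) ≡ - unless b z
unless-neg true  z = refl
unless-neg false z = refl

∑-neg : ∀ n (f : Subset n → ℤ) → ∑ n (λ W → - f W) ≡ - ∑ n f
∑-neg zero    f = refl
∑-neg (suc n) f = trans (cong₂ _+ℤ_ (∑-neg n (f ∘ (false ∷_))) (∑-neg n (f ∘ (true ∷_))))
                        (≡.sym (IntP.neg-distrib-+ (∑ n (f ∘ (false ∷_))) (∑ n (f ∘ (true ∷_)))))

∑-alternating : ∀ {n} u (f : Subset n → ℤ) → (∀ W → lookup W u ≡ false → f (W [ u ]≔ true) ≡ - f W) → ∑ n f ≡ 0ℤ
∑-alternating {n} u f flips = begin
  ∑ n f                                                       ≡⟨ ∑-pair-at u f ⟩
  ∑ n (λ W → unless (lookup W u) (f W +ℤ f (W [ u ]≔ true)))  ≡⟨ ∑-cong n (λ W → unless-cong (lookup W u) (cancel W)) ⟩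
  ∑ n (λ W → unless (lookup W u) 0ℤ)                          ≡⟨ ∑-cong n (λ W → unless-0 (lookup W u)) ⟩
  ∑ n (λ _ → 0ℤ)                                              ≡⟨ ∑-ε n ⟩
  0ℤ                                                          ∎
  where
  open ≡-Reasoning
  cancel : ∀ W → lookup W u ≡ false → f W +ℤ f (W [ u ]≔ true) ≡ 0ℤ
  cancel W u∉W = trans (cong (f W +ℤ_) (flips W u∉W)) (IntP.+-inverseʳ (f W))
  unless-0 : ∀ b → unless b 0ℤ ≡ 0ℤ
  unless-0 true  = refl
  unless-0 false = refl

∑-avoiding-sign : ∀ {n} {u u′ : Fin n} → u′ ≢ u → ∑ n (λ W → unless (lookup W u) (-1ℤ ^ℤ ∣ W ∣)) ≡ 0ℤ
∑-avoiding-sign {u = u} {u′} u′≢u = ∑-alternating u′ _ λ W u′∉W →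
  trans (cong₂ unless (lookup∘update′ (u′≢u ∘ ≡.sym) W true) (sign-insert W u′∉W)) (unless-neg (lookup W u) _)

γ-extend-at : ∀ {n} (G : Graph n) N v (F : Subset n → ℤ) →
  (∀ W → lookup W v ≡ false → c₁ (ν (extend G N) (true ∷ W)) +ℤ c₁ (ν (extend G N) (true ∷ W [ v ]≔ true)) ≡ F W) →
  γ (extend G N) ≡ γ G +ℤ ∑ n (λ W → unless (lookup W v) (F W))
γ-extend-at {n} G N v F pair = begin
  γ G′                                                                  ≡⟨ γ≡∑c₁ν G′ ⟩
  ∑ n (λ W → c₁ (ν G′ (false ∷ W))) +ℤ ∑ n (λ W → c₁ (ν G′ (true ∷ W)))
    ≡⟨ cong₂ _+ℤ_ (∑-cong n λ W → cong c₁ (ν-cong G′ (false ∷ W) G W (kerSize-extend-outside G N W))) (∑-pair-at v _) ⟩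
  ∑ n (λ W → c₁ (ν G W))
    +ℤ ∑ n (λ W → unless (lookup W v) (c₁ (ν G′ (true ∷ W)) +ℤ c₁ (ν G′ (true ∷ W [ v ]≔ true))))
    ≡⟨ cong₂ _+ℤ_ (≡.sym (γ≡∑c₁ν G)) (∑-cong n λ W → unless-cong (lookup W v) (pair W)) ⟩
  γ G +ℤ ∑ n (λ W → unless (lookup W v) (F W))                         ∎
  where
  open ≡-Reasoning
  G′ = extend G N

γ-addPendant : ∀ {n} (G : Graph n) {u u′ : Fin n} → u′ ≢ u → γ (addPendant G u) ≡ γ G
γ-addPendant {n} G {u} u′≢u = begin
  γ (addPendant G u)                                     ≡⟨ γ-extend-at G _ u (λ W → -1ℤ ^ℤ ∣ W ∣) pair ⟩
  γ G +ℤ ∑ n (λ W → unless (lookup W u) (-1ℤ ^ℤ ∣ W ∣))  ≡⟨ cong (γ G +ℤ_) (∑-avoiding-sign u′≢u) ⟩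
  γ G +ℤ 0ℤ                                              ≡⟨ IntP.+-identityʳ (γ G) ⟩
  γ G                                                    ∎
  where
  open ≡-Reasoning
  G′ = addPendant G u
  pair : ∀ W → lookup W u ≡ false → c₁ (ν G′ (true ∷ W)) +ℤ c₁ (ν G′ (true ∷ W [ u ]≔ true)) ≡ -1ℤ ^ℤ ∣ W ∣
  pair W u∉W = begin
    c₁ (ν G′ (true ∷ W)) +ℤ c₁ (ν G′ (true ∷ W [ u ]≔ true))
      ≡⟨ cong₂ (λ a b → c₁ a +ℤ c₁ b) (ν-double G′ (true ∷ W) G W (kerSize-pendant-new G W u∉W))
                                      (ν-cong G′ (true ∷ W [ u ]≔ true) G W (kerSize-pendant-both G W u∉W)) ⟩
    c₁ (suc (ν G W)) +ℤ c₁ (ν G W)   ≡⟨ IntP.+-comm (c₁ (suc (ν G W))) (c₁ (ν G W)) ⟩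
    c₁ (ν G W) +ℤ c₁ (suc (ν G W))   ≡⟨ c₁-pair-ν G W ⟩
    -1ℤ ^ℤ ∣ W ∣                     ∎

γ-addFalseTwin : ∀ {n} (G : Graph n) {v w : Fin n} → adj G v w ≡ true → γ (addFalseTwin G v) ≡ γ G
γ-addFalseTwin {n} G {v} {w} vw = begin
  γ (addFalseTwin G v)
    ≡⟨ γ-extend-at G _ v (λ W → - (-1ℤ ^ℤ ∣ W ∣)) pair ⟩
  γ G +ℤ ∑ n (λ W → unless (lookup W v) (- (-1ℤ ^ℤ ∣ W ∣)))
    ≡⟨ cong (γ G +ℤ_) (∑-cong n λ W → unless-neg (lookup W v) _) ⟩
  γ G +ℤ ∑ n (λ W → - unless (lookup W v) (-1ℤ ^ℤ ∣ W ∣))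
    ≡⟨ cong (γ G +ℤ_) (trans (∑-neg n _) (cong -_ (∑-avoiding-sign w≢v))) ⟩
  γ G +ℤ 0ℤ
    ≡⟨ IntP.+-identityʳ (γ G) ⟩
  γ G ∎
  where
  open ≡-Reasoning
  G″ = addFalseTwin G v
  w≢v : w ≢ v
  w≢v refl with () ← trans (≡.sym vw) (irrefl G w)
  pair : ∀ W → lookup W v ≡ false → c₁ (ν G″ (true ∷ W)) +ℤ c₁ (ν G″ (true ∷ W [ v ]≔ true)) ≡ - (-1ℤ ^ℤ ∣ W ∣)
  pair W v∉W = begin
    c₁ (ν G″ (true ∷ W)) +ℤ c₁ (ν G″ (true ∷ W [ v ]≔ true))
      ≡⟨ cong₂ (λ a b → c₁ a +ℤ c₁ b) (ν-cong G″ (true ∷ W) G W⁺ (kerSize-falseTwin-new G W v∉W))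
                                      (ν-double G″ (true ∷ W⁺) G W⁺ (kerSize-falseTwin-both G W v∉W)) ⟩
    c₁ (ν G W⁺) +ℤ c₁ (suc (ν G W⁺))  ≡⟨ c₁-pair-ν G W⁺ ⟩
    -1ℤ ^ℤ ∣ W⁺ ∣                      ≡⟨ sign-insert W v∉W ⟩
    - (-1ℤ ^ℤ ∣ W ∣)                   ∎
    where W⁺ = W [ v ]≔ true

γ-addTrueTwin : ∀ {n} (G : Graph n) v → γ (addTrueTwin G v) ≡ γ G +ℤ γ G
γ-addTrueTwin {n} G v = begin
  γ (addTrueTwin G v)
    ≡⟨ γ-extend-at G _ v _ pair ⟩
  γ G +ℤ ∑ n (λ W → unless (lookup W v) (c₁ (ν G W) +ℤ c₁ (ν G (W [ v ]≔ true))))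
    ≡⟨ cong (γ G +ℤ_) (∑-pair-at v (λ W → c₁ (ν G W))) ⟨
  γ G +ℤ ∑ n (λ W → c₁ (ν G W))
    ≡⟨ cong (γ G +ℤ_) (γ≡∑c₁ν G) ⟨
  γ G +ℤ γ G ∎
  where
  open ≡-Reasoning
  G‴ = addTrueTwin G v
  pair : ∀ W → lookup W v ≡ false →
         c₁ (ν G‴ (true ∷ W)) +ℤ c₁ (ν G‴ (true ∷ W [ v ]≔ true)) ≡ c₁ (ν G W) +ℤ c₁ (ν G (W [ v ]≔ true))
  pair W v∉W = trans (cong₂ (λ a b → c₁ a +ℤ c₁ b) (ν-cong G‴ (true ∷ W) G (W [ v ]≔ true) (kerSize-trueTwin-new G W v∉W))
                                                     (ν-cong G‴ (true ∷ W [ v ]≔ true) G W (kerSize-trueTwin-both G W v∉W)))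
                     (IntP.+-comm (c₁ (ν G (W [ v ]≔ true))) (c₁ (ν G W)))

another-vertex : ∀ {n} → 2 ≤ n → (u : Fin n) → Σ (Fin n) (λ u′ → u′ ≢ u)
another-vertex (s≤s (s≤s _)) zero    = suc zero , λ ()
another-vertex (s≤s (s≤s _)) (suc u) = zero , λ ()

corollary4p15 : ((n : ℕ) (G : Graph n) (u : Fin n) → 2 ≤ n → γ (addPendant G u) ≡ γ G)
    × ((n : ℕ) (G : Graph n) (v : Fin n) → NonIsolated G v → γ (addFalseTwin G v) ≡ γ G)
    × ((n : ℕ) (G : Graph n) (v : Fin n) → NonIsolated G v → γ (addTrueTwin G v) ≡ + 2 * γ G)
corollary4p15 =
    (λ n G u 2≤n → γ-addPendant G (proj₂ (another-vertex 2≤n u)))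
  , (λ n G v (w , vw) → γ-addFalseTwin G vw)
  -- (3) holds for isolated v as well.
  , (λ n G v _ → trans (γ-addTrueTwin G v) (≡.sym (two-times (γ G))))
  where
  two-times : ∀ i → + 2 * i ≡ i +ℤ i
  two-times i = trans (IntP.*-distribʳ-+ i 1ℤ 1ℤ) (cong₂ _+ℤ_ (IntP.*-identityˡ i) (IntP.*-identityˡ i))
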